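{- Let $n\ge1$, $\boldsymbol a\in\{0,1\}^{n-1}$, $\vec\sigma\in\{0,1\}^n$ and $L=\sum_{i=1}^{n-1}a_i(1-2\sigma_i)$. Then the Haar coefficient of $\Delta(\cdot,\mathcal{P}_{\boldsymbol a}(\vec\sigma))$ with $\boldsymbol j=(0,-1)$, $\boldsymbol m=(0,0)$ is $$\mu_{\boldsymbol j,\boldsymbol m}=\frac1{2^{2n+2}}-\frac1{2^{n+3}}+\frac1{2^{n+3}}L-\frac1{2^{2n+1}}\sigma_n.$$
   Context: $\oplus$ denotes addition modulo 2. For an integer $n\ge1$, $\boldsymbol{a}=(a_1,\dots,a_{n-1})\in\{0,1\}^{n-1}$ and $\vec{\sigma}=(\sigma_1,\dots,\sigma_n)\in\{0,1\}^n$, let $\mathcal{P}_{\boldsymbol{a}}(\vec{\sigma})\subset[0,1)^2$ be the set of the $2^n$ points $\bigl(\frac{t_n}{2}+\dots+\frac{t_1}{2^n},\ \frac{b_1}{2}+\dots+\frac{b_n}{2^n}\bigr)$, $(t_1,\dots,t_n)\in\{0,1\}^n$, with $b_k=t_k\oplus a_kt_n\oplus\sigma_k$ for $1\le k\le n-1$ and $b_n=t_n\oplus\sigma_n$. For an $N$-point set $\mathcal{P}$ the discrepancy function is $\Delta(\boldsymbol{t},\mathcal{P})=\frac1N\#\{\boldsymbol{z}\in\mathcal{P}:\boldsymbol{z}\in[0,t_1)\times[0,t_2)\}-t_1t_2$. Haar functions: $h_{0,0}$ is $+1$ on $[0,\frac12)$ and $-1$ on $[\frac12,1)$; $h_{ -1,0}=\mathbf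 1_{[0,1)}$; $h_{(0,-1),(0,0)}(\boldsymbol t)=h_{0,0}(t_1)h_{ -1,0}(t_2)$, and $\mu_{\boldsymbol j,\boldsymbol m}=\int_{[0,1)^2}\Delta(\boldsymbol t,\mathcal P)h_{\boldsymbol j,\boldsymbol m}(\boldsymbol t)\,d\boldsymbol t$. -}

module Defs where

open import Data.Bool using (Bool; true; false; _xor_; _∧_; if_then_else_)
open import Data.Nat as ℕ using (ℕ; zero; suc; _≤ᵇ_; _<ᵇ_)
open import Data.Nat.Properties using (m^n≢0)
open import Data.Integer as ℤ using (ℤ; +_)
open import Data.Rational as ℚ using (ℚ; _/_)
open import Data.Vec using (Vec; []; _∷_; _∷ʳ_; init; last; zipWith; map)
open import Data.List as List using (List; []; _∷_; _++_; length; filter; upTo)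
open import Relation.Nullary.Decidable using (T?)
open import Data.Bool using (T)
open import Data.Product using (_×_; _,_; proj₁; proj₂)

bit : Bool → ℕ
bit false = 0
bit true  = 1

dy : ℤ → ℕ → ℚ
dy z e = _/_ z (2 ℕ.^ e) {{m^n≢0 2 e}}

allVecs : (m : ℕ) → List (Vec Bool m)
allVecs zero    = [] ∷ []
allVecs (suc m) = List.map (false ∷_) (allVecs m) ++ List.map (true ∷_) (allVecs m)

binLE : ∀ {m} → Vec Bool m → ℕ
binLE []       = 0
binLE (c ∷ cs) = bit c ℕ.+ 2 ℕ.* binLE cs

binBE : ∀ {m} → Vec Bool m → ℕ
binBE {suc m} (c ∷ cs) = bit c ℕ.* 2 ℕ.^ m ℕ.+ binBE cs
binBE {zero}  []       = 0

-- Here n = suc k, a = (a₁,…,a_{n-1}) : Vec Bool k, σ = (σ₁,…,σ_n), t = (t₁,…,t_n).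
-- The digits b = (b₁,…,b_n): b_i = t_i ⊕ a_i t_n ⊕ σ_i (i < n), b_n = t_n ⊕ σ_n.
bDigits : ∀ {k} → Vec Bool k → Vec Bool (suc k) → Vec Bool (suc k) → Vec Bool (suc k)
bDigits a σ t =
  zipWith _xor_ (zipWith _xor_ (init t) (map (_∧ last t) a)) (init σ)
    ∷ʳ (last t xor last σ)

-- The point of P_a(σ) indexed by t, given by the numerators (X, Y) of its
-- coordinates over the common denominator 2^n:
--   x = t_n/2 + … + t_1/2^n = X / 2^n,  y = b_1/2 + … + b_n/2^n = Y / 2^n.
point : ∀ {k} → Vec Bool k → Vec Bool (suc k) → Vec Bool (suc k) → ℕ × ℕ
point a σ t = binLE t , binBE (bDigits a σ t)

pointSet : ∀ {k} → Vec Bool k → Vec Bool (suc k) → List (ℕ × ℕ)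
pointSet {k} a σ = List.map (point a σ) (allVecs (suc k))

sumℚ : List ℚ → ℚ
sumℚ = List.foldr ℚ._+_ ℚ.0ℚ

-- Let n = suc k, M = 2^n.  All points have coordinates (X/M, Y/M) with
-- X, Y ∈ ℕ.  Split [0,1)^2 into the M^2 dyadic cells
--   C_{i,j} = [i/M,(i+1)/M) × [j/M,(j+1)/M),   0 ≤ i, j < M.
-- For t in the interior of C_{i,j}, (X/M, Y/M) ∈ [0,t₁) × [0,t₂) iff
-- X ≤ i and Y ≤ j; hence on C_{i,j} (up to a null set)
--   Δ(t, P) = count(i,j) / M − t₁ t₂,     (N = 2^n = M points)
-- and h_{(0,-1),(0,0)}(t) = h_{0,0}(t₁) is the constant +1 if (i+1)/M ≤ 1/2
-- (i.e. 2i < M) and −1 otherwise.  The integral over the cell is then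
--   ∫_{C_{i,j}} Δ h = h_i · ( count(i,j) / M^3
--                             − ((2i+1)/(2M^2)) · ((2j+1)/(2M^2)) ),
-- using ∫_{i/M}^{(i+1)/M} s ds = (2i+1)/(2M^2).  μ is the sum over all cells.

countBelow : List (ℕ × ℕ) → ℕ → ℕ → ℕ
countBelow P i j = length (filter (λ z → T? ((proj₁ z ≤ᵇ i) ∧ (proj₂ z ≤ᵇ j))) P)

haarCol : (n i : ℕ) → ℤ
haarCol n i = if (2 ℕ.* i) <ᵇ (2 ℕ.^ n) then + 1 else ℤ.- (+ 1)

cellIntegralΔ : (n : ℕ) → List (ℕ × ℕ) → ℕ → ℕ → ℚ
cellIntegralΔ n P i j =
  dy (+ countBelow P i j) (3 ℕ.* n)
  ℚ.- dy (+ ((2 ℕ.* i ℕ.+ 1) ℕ.* (2 ℕ.* j ℕ.+ 1))) (4 ℕ.* n ℕ.+ 2)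

haarCoeff-0-1-00 : (n : ℕ) → List (ℕ × ℕ) → ℚ
haarCoeff-0-1-00 n P =
  sumℚ (List.map (λ i → sumℚ (List.map (λ j →
      (haarCol n i ℚ./ 1) ℚ.* cellIntegralΔ n P i j)
    (upTo (2 ℕ.^ n)))) (upTo (2 ℕ.^ n)))

Lsum : ∀ {k} → Vec Bool k → Vec Bool k → ℤ
Lsum []       []       = + 0
Lsum (a ∷ as) (s ∷ ss) = (+ bit a) ℤ.* (+ 1 ℤ.- (+ 2) ℤ.* (+ bit s)) ℤ.+ Lsum as ss

-- Write N = 2ⁿ = 2K. The discrepancy is affine on every cell of the N × N grid, so 4N⁴μ is the integer
-- Σᵢⱼ hᵢ (4N·#{points (X, Y) with X ≤ i, Y ≤ j} − (2i+1)(2j+1)), hᵢ = ±1 the sign of h₀,₀ on column i.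
-- Exchanging sums, each point contributes H(X)(N − Y) with H(X) = Σ_{i ≥ X} hᵢ, which is −x for X = x < K
-- and x − K for X = K + x, while the second part is the constant N⁴/2. Splitting the point set by its last
-- digit tₙ makes Σ H(X)(N − Y) bilinear in x and in the reversed value of the shifted digits
-- (tᵢ ⊕ aᵢtₙ ⊕ σᵢ)ᵢ, so only first moments and one cross moment over {0,1}^{n−1} occur, and these follow by
-- induction on n. The cross moment sees the shift only through its Hamming weight, and the difference of
-- the weights for tₙ = 1 and tₙ = 0 is L.
module Submission where

open import Defs

module Sums where

  open import Data.Integer using (ℤ; 0ℤ; 1ℤ; +_; -_; _+_; _-_; _*_)
  open import Data.Integer.Properties
    using (+-identityˡ; +-assoc; *-zeroʳ; *-comm; *-distribˡ-+; neg-distrib-+; +-commutativeSemigroup)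
  open import Algebra.Properties.CommutativeSemigroup +-commutativeSemigroup using (interchange)
  open import Data.Integer.Tactic.RingSolver using (solve-∀)
  open import Data.List using (List; []; _∷_; _++_; map; length)
  open import Data.List.Membership.Propositional using (_∈_)
  open import Data.List.Relation.Unary.Any using (here; there)
  open import Function using (_∘_)
  open import Relation.Binary.PropositionalEquality using (_≡_; refl; sym; trans; cong; cong₂; module ≡-Reasoning)
  open ≡-Reasoning

  private variable
    A B : Set

  ∑ : List A → (A → ℤ) → ℤ
  ∑ []       f = 0ℤ
  ∑ (x ∷ xs) f = f x + ∑ xs f

  infix 5 ∑
  syntax ∑ xs (λ x → e) = ∑[ x ∈ xs ] e

  ∑-cong-∈ : ∀ (xs : List A) {f g : A → ℤ} → (∀ {x} → x ∈ xs → f x ≡ g x) → ∑ xs f ≡ ∑ xs g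
  ∑-cong-∈ []       eq = refl
  ∑-cong-∈ (x ∷ xs) eq = cong₂ _+_ (eq (here refl)) (∑-cong-∈ xs (eq ∘ there))

  ∑-cong : ∀ (xs : List A) {f g : A → ℤ} → (∀ x → f x ≡ g x) → ∑ xs f ≡ ∑ xs g
  ∑-cong xs eq = ∑-cong-∈ xs (λ {x} _ → eq x)

  ∑-++ : ∀ (xs ys : List A) f → ∑ (xs ++ ys) f ≡ ∑ xs f + ∑ ys f
  ∑-++ []       ys f = sym (+-identityˡ _)
  ∑-++ (x ∷ xs) ys f = trans (cong (λ s → f x + s) (∑-++ xs ys f)) (sym (+-assoc (f x) _ _))

  ∑-map : ∀ (g : B → A) xs f → ∑ (map g xs) f ≡ ∑ xs (f ∘ g)
  ∑-map g []       f = refl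
  ∑-map g (x ∷ xs) f = cong (λ s → f (g x) + s) (∑-map g xs f)

  ∑-+ : ∀ (xs : List A) f g → ∑[ x ∈ xs ] (f x + g x) ≡ ∑ xs f + ∑ xs g
  ∑-+ []       f g = refl
  ∑-+ (x ∷ xs) f g = trans (cong (λ s → f x + g x + s) (∑-+ xs f g)) (interchange (f x) (g x) _ _)

  ∑-neg : ∀ (xs : List A) f → ∑[ x ∈ xs ] - f x ≡ - ∑ xs f
  ∑-neg []       f = refl
  ∑-neg (x ∷ xs) f = trans (cong (λ s → - f x + s) (∑-neg xs f)) (sym (neg-distrib-+ (f x) _))

  ∑-- : ∀ (xs : List A) f g → ∑[ x ∈ xs ] (f x - g x) ≡ ∑ xs f - ∑ xs g
  ∑-- xs f g = trans (∑-+ xs f (λ x → - g x)) (cong (λ s → ∑ xs f + s) (∑-neg xs g))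

  ∑-const : ∀ (xs : List A) c → ∑[ x ∈ xs ] c ≡ c * + length xs
  ∑-const []       c = sym (*-zeroʳ c)
  ∑-const (x ∷ xs) c = trans (cong (λ s → c + s) (∑-const xs c)) (distrib c (+ length xs))
    where
    distrib : ∀ c n → c + c * n ≡ c * (1ℤ + n)
    distrib = solve-∀

  ∑-*ˡ : ∀ (xs : List A) c f → ∑[ x ∈ xs ] c * f x ≡ c * ∑ xs f
  ∑-*ˡ []       c f = sym (*-zeroʳ c)
  ∑-*ˡ (x ∷ xs) c f = trans (cong (λ s → c * f x + s) (∑-*ˡ xs c f)) (sym (*-distribˡ-+ c (f x) _))

  ∑-*ʳ : ∀ (xs : List A) c f → ∑[ x ∈ xs ] f x * c ≡ ∑ xs f * c
  ∑-*ʳ xs c f = trans (∑-cong xs (λ x → *-comm (f x) c)) (trans (∑-*ˡ xs c f) (*-comm c _))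

  ∑-affine : ∀ (xs : List A) α β f → ∑[ x ∈ xs ] (α + β * f x) ≡ α * + length xs + β * ∑ xs f
  ∑-affine xs α β f = trans (∑-+ xs (λ _ → α) (λ x → β * f x)) (cong₂ _+_ (∑-const xs α) (∑-*ˡ xs β f))

  ∑-bilinear : ∀ (xs : List A) α β γ δ f g →
    ∑[ x ∈ xs ] (α + β * f x + γ * g x + δ * (f x * g x))
      ≡ α * + length xs + β * ∑ xs f + γ * ∑ xs g + δ * (∑[ x ∈ xs ] f x * g x)
  ∑-bilinear []       α β γ δ f g = zeros α β γ δ
    where
    zeros : ∀ α β γ δ → 0ℤ ≡ α * 0ℤ + β * 0ℤ + γ * 0ℤ + δ * 0ℤ
    zeros = solve-∀
  ∑-bilinear (x ∷ xs) α β γ δ f g =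
    trans (cong (λ s → α + β * f x + γ * g x + δ * (f x * g x) + s) (∑-bilinear xs α β γ δ f g))
          (collect α β γ δ (f x) (g x) (f x * g x) (+ length xs) _ _ _)
    where
    collect : ∀ α β γ δ a b c N F G H →
      (α + β * a + γ * b + δ * c) + (α * N + β * F + γ * G + δ * H)
        ≡ α * (1ℤ + N) + β * (a + F) + γ * (b + G) + δ * (c + H)
    collect = solve-∀

  ∑-comm : ∀ (xs : List A) (ys : List B) (f : A → B → ℤ) →
           ∑[ x ∈ xs ] ∑[ y ∈ ys ] f x y ≡ ∑[ y ∈ ys ] ∑[ x ∈ xs ] f x y
  ∑-comm []       ys f = sym (∑-zero ys)
    where
    ∑-zero : ∀ (ys : List B) → ∑[ y ∈ ys ] 0ℤ ≡ 0ℤ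
    ∑-zero []       = refl
    ∑-zero (y ∷ ys) = trans (+-identityˡ _) (∑-zero ys)
  ∑-comm (x ∷ xs) ys f =
    trans (cong (λ s → ∑ ys (f x) + s) (∑-comm xs ys f)) (sym (∑-+ ys (f x) (λ y → ∑[ x ∈ xs ] f x y)))

  ∑∑-product : ∀ (xs : List A) (ys : List B) c (g : A → B → ℤ) (p : A → ℤ) (q : B → ℤ) →
    ∑[ x ∈ xs ] ∑[ y ∈ ys ] (c * g x y - p x * q y) ≡ c * (∑[ x ∈ xs ] ∑[ y ∈ ys ] g x y) - ∑ xs p * ∑ ys q
  ∑∑-product xs ys c g p q = begin
    ∑[ x ∈ xs ] ∑[ y ∈ ys ] (c * g x y - p x * q y)
      ≡⟨ ∑-cong xs (λ x → trans (∑-- ys (λ y → c * g x y) (λ y → p x * q y))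
                                (cong₂ _-_ (∑-*ˡ ys c (g x)) (∑-*ˡ ys (p x) q))) ⟩
    ∑[ x ∈ xs ] (c * ∑ ys (g x) - p x * ∑ ys q)
      ≡⟨ ∑-- xs (λ x → c * ∑ ys (g x)) (λ x → p x * ∑ ys q) ⟩
    (∑[ x ∈ xs ] c * ∑ ys (g x)) - (∑[ x ∈ xs ] p x * ∑ ys q)
      ≡⟨ cong₂ _-_ (∑-*ˡ xs c (λ x → ∑ ys (g x))) (∑-*ʳ xs (∑ ys q) p) ⟩
    c * (∑[ x ∈ xs ] ∑[ y ∈ ys ] g x y) - ∑ xs p * ∑ ys q ∎

module NatToInt where

  open import Data.Integer using (+_; _-_; _*_)
  open import Data.Integer.Properties using (pos-*; m-n≡m⊖n; ⊖-≥)
  open import Data.Nat using (_∸_; _≤_; _+_; _^_)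
  open import Data.Nat.Properties using (^-distribˡ-+-*)
  open import Relation.Binary.PropositionalEquality using (_≡_; sym; trans; cong)

  pos-∸ : ∀ {m n} → n ≤ m → + (m ∸ n) ≡ + m - + n
  pos-∸ {m} {n} n≤m = sym (trans (m-n≡m⊖n m n) (⊖-≥ n≤m))

  pos-2^-+ : ∀ m n → + 2 ^ (m + n) ≡ + 2 ^ m * + 2 ^ n
  pos-2^-+ m n = trans (cong +_ (^-distribˡ-+-* 2 m n)) (pos-* (2 ^ m) (2 ^ n))

module RangeSums where

  open Sums
  open import Data.Bool using (true; false)
  open import Data.Integer using (ℤ; 0ℤ; +_; _+_; _*_)
  open import Data.Integer.Properties using (+-identityʳ; +-assoc; pos-+; pos-*)
  open import Data.Integer.Tactic.RingSolver using (solve-∀)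
  open import Data.List using ([_]; _∷ʳ_; upTo)
  open import Data.List.Properties using (upTo-∷ʳ)
  open import Data.List.Membership.Propositional.Properties using (∈-upTo⁻)
  open import Data.Nat as ℕ using (ℕ; zero; suc; _∸_; _≤ᵇ_; _<_)
  import Data.Nat.Properties as ℕ
  open import Relation.Nullary.Reflects using (ofʸ; ofⁿ)
  open import Relation.Binary.PropositionalEquality using (_≡_; refl; sym; trans; cong; cong₂; module ≡-Reasoning)
  open ≡-Reasoning

  ∑-upTo-suc : ∀ n (f : ℕ → ℤ) → ∑ (upTo (suc n)) f ≡ ∑ (upTo n) f + f n
  ∑-upTo-suc n f = begin
    ∑ (upTo (suc n)) f        ≡⟨ cong (λ l → ∑ l f) (upTo-∷ʳ n) ⟨
    ∑ (upTo n ∷ʳ n) f         ≡⟨ ∑-++ (upTo n) [ n ] f ⟩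
    ∑ (upTo n) f + (f n + 0ℤ) ≡⟨ cong (λ s → ∑ (upTo n) f + s) (+-identityʳ (f n)) ⟩
    ∑ (upTo n) f + f n        ∎

  ∑-upTo-+ : ∀ m n (f : ℕ → ℤ) → ∑ (upTo (m ℕ.+ n)) f ≡ ∑ (upTo m) f + (∑[ i ∈ upTo n ] f (m ℕ.+ i))
  ∑-upTo-+ m zero    f = trans (cong (λ l → ∑ (upTo l) f) (ℕ.+-identityʳ m)) (sym (+-identityʳ _))
  ∑-upTo-+ m (suc n) f = begin
    ∑ (upTo (m ℕ.+ suc n)) f                       ≡⟨ cong (λ l → ∑ (upTo l) f) (ℕ.+-suc m n) ⟩
    ∑ (upTo (suc (m ℕ.+ n))) f                     ≡⟨ ∑-upTo-suc (m ℕ.+ n) f ⟩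
    ∑ (upTo (m ℕ.+ n)) f + f (m ℕ.+ n)             ≡⟨ cong (_+ f (m ℕ.+ n)) (∑-upTo-+ m n f) ⟩
    ∑ (upTo m) f + ∑ (upTo n) f′ + f′ n            ≡⟨ +-assoc (∑ (upTo m) f) _ _ ⟩
    ∑ (upTo m) f + (∑ (upTo n) f′ + f′ n)          ≡⟨ cong (λ s → ∑ (upTo m) f + s) (∑-upTo-suc n f′) ⟨
    ∑ (upTo m) f + ∑ (upTo (suc n)) f′             ∎
    where
    f′ = λ i → f (m ℕ.+ i)

  ∑-upTo-cong : ∀ n {f g : ℕ → ℤ} → (∀ i → i < n → f i ≡ g i) → ∑ (upTo n) f ≡ ∑ (upTo n) g
  ∑-upTo-cong n eq = ∑-cong-∈ (upTo n) (λ i∈ → eq _ (∈-upTo⁻ i∈))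

  suc-∸ : ∀ X n → suc n ∸ X ≡ n ∸ X ℕ.+ bit (X ≤ᵇ n)
  suc-∸ X n with X ≤ᵇ n | ℕ.≤ᵇ-reflects-≤ X n
  ... | true  | ofʸ X≤n = trans (ℕ.+-∸-assoc 1 X≤n) (ℕ.+-comm 1 (n ∸ X))
  ... | false | ofⁿ X≰n = trans (ℕ.m≤n⇒m∸n≡0 n<X) (sym (cong (ℕ._+ 0) (ℕ.m≤n⇒m∸n≡0 (ℕ.<⇒≤ n<X))))
    where
    n<X = ℕ.≰⇒> X≰n

  ∑-upTo-≤ᵇ : ∀ X n → ∑[ i ∈ upTo n ] + bit (X ≤ᵇ i) ≡ + (n ∸ X)
  ∑-upTo-≤ᵇ X zero    = cong +_ (sym (ℕ.0∸n≡0 X))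
  ∑-upTo-≤ᵇ X (suc n) = begin
    ∑[ i ∈ upTo (suc n) ] + bit (X ≤ᵇ i)              ≡⟨ ∑-upTo-suc n _ ⟩
    (∑[ i ∈ upTo n ] + bit (X ≤ᵇ i)) + + bit (X ≤ᵇ n) ≡⟨ cong (_+ + bit (X ≤ᵇ n)) (∑-upTo-≤ᵇ X n) ⟩
    + (n ∸ X) + + bit (X ≤ᵇ n)                        ≡⟨ pos-+ (n ∸ X) _ ⟨
    + (n ∸ X ℕ.+ bit (X ≤ᵇ n))                        ≡⟨ cong +_ (suc-∸ X n) ⟨
    + (suc n ∸ X)                                     ∎

  ≤ᵇ-suc : ∀ X i → (suc X ≤ᵇ suc i) ≡ (X ≤ᵇ i)
  ≤ᵇ-suc zero    i = refl
  ≤ᵇ-suc (suc X) i = refl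

  ≤ᵇ-+ʳ : ∀ c X i → (X ≤ᵇ c ℕ.+ i) ≡ (X ∸ c ≤ᵇ i)
  ≤ᵇ-+ʳ zero    X       i = refl
  ≤ᵇ-+ʳ (suc c) zero    i = refl
  ≤ᵇ-+ʳ (suc c) (suc X) i = trans (≤ᵇ-suc X (c ℕ.+ i)) (≤ᵇ-+ʳ c X i)

  ∑-upTo-odd : ∀ n → ∑[ j ∈ upTo n ] + (2 ℕ.* j ℕ.+ 1) ≡ + n * + n
  ∑-upTo-odd zero    = refl
  ∑-upTo-odd (suc n) = begin
    ∑[ j ∈ upTo (suc n) ] + (2 ℕ.* j ℕ.+ 1)                  ≡⟨ ∑-upTo-suc n _ ⟩
    (∑[ j ∈ upTo n ] + (2 ℕ.* j ℕ.+ 1)) + + (2 ℕ.* n ℕ.+ 1) ≡⟨ cong₂ _+_ (∑-upTo-odd n) (odd n) ⟩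
    + n * + n + (+ 2 * + n + + 1)                            ≡⟨ square (+ n) ⟩
    + suc n * + suc n                                        ∎
    where
    odd : ∀ j → + (2 ℕ.* j ℕ.+ 1) ≡ + 2 * + j + + 1
    odd j = trans (pos-+ (2 ℕ.* j) 1) (cong (_+ + 1) (pos-* 2 j))
    square : ∀ n → n * n + (+ 2 * n + + 1) ≡ (+ 1 + n) * (+ 1 + n)
    square = solve-∀

module Fractions where

  open Sums using (∑)
  open import Data.Integer as ℤ using (ℤ; +_; 0ℤ)
  import Data.Integer.Properties as ℤ
  open import Data.Integer.Tactic.RingSolver using (solve-∀)
  open import Data.List using (List; []; _∷_; map)
  open import Data.Nat as ℕ using (suc; NonZero)
  import Data.Nat.Properties as ℕ
  open import Data.Rational using (_/_; _+_; _-_; _*_; -_; toℚᵘ)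
  open import Data.Rational.Properties
    using (toℚᵘ-injective; toℚᵘ-fromℚᵘ; toℚᵘ-homo-+; toℚᵘ-homo-*; toℚᵘ-homo‿-)
  open import Data.Rational.Unnormalised as ℚᵘ using (mkℚᵘ; *≡*) renaming (_≃_ to _≃ᵘ_)
  import Data.Rational.Unnormalised.Properties as ℚᵘ
  open import Relation.Binary.PropositionalEquality using (_≡_; refl; sym; trans; cong)
  open ℚᵘ.≃-Reasoning

  toℚᵘ-/ : ∀ z d-1 → toℚᵘ (z / suc d-1) ≃ᵘ mkℚᵘ z d-1
  toℚᵘ-/ z d-1 = toℚᵘ-fromℚᵘ (mkℚᵘ z d-1)

  /-+ : ∀ z w d .{{_ : NonZero d}} → z / d + w / d ≡ (z ℤ.+ w) / d
  /-+ z w (suc d-1) = toℚᵘ-injective (begin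
    toℚᵘ (z / D + w / D)           ≈⟨ toℚᵘ-homo-+ (z / D) (w / D) ⟩
    toℚᵘ (z / D) ℚᵘ.+ toℚᵘ (w / D) ≈⟨ ℚᵘ.+-cong (toℚᵘ-/ z d-1) (toℚᵘ-/ w d-1) ⟩
    mkℚᵘ z d-1 ℚᵘ.+ mkℚᵘ w d-1     ≈⟨ *≡* common-denominator ⟩
    mkℚᵘ (z ℤ.+ w) d-1             ≈⟨ toℚᵘ-/ (z ℤ.+ w) d-1 ⟨
    toℚᵘ ((z ℤ.+ w) / D)           ∎)
    where
    D = suc d-1
    distrib : ∀ z w d → (z ℤ.* d ℤ.+ w ℤ.* d) ℤ.* d ≡ (z ℤ.+ w) ℤ.* (d ℤ.* d)
    distrib = solve-∀
    common-denominator : (z ℤ.* + D ℤ.+ w ℤ.* + D) ℤ.* + D ≡ (z ℤ.+ w) ℤ.* + (D ℕ.* D)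
    common-denominator = trans (distrib z w (+ D)) (cong ((z ℤ.+ w) ℤ.*_) (sym (ℤ.pos-* D D)))

  neg-/ : ∀ z d .{{_ : NonZero d}} → - (z / d) ≡ (ℤ.- z) / d
  neg-/ z (suc d-1) = toℚᵘ-injective (begin
    toℚᵘ (- (z / suc d-1))   ≈⟨ toℚᵘ-homo‿- (z / suc d-1) ⟩
    ℚᵘ.- toℚᵘ (z / suc d-1)  ≈⟨ ℚᵘ.-‿cong (toℚᵘ-/ z d-1) ⟩
    mkℚᵘ (ℤ.- z) d-1         ≈⟨ toℚᵘ-/ (ℤ.- z) d-1 ⟨
    toℚᵘ ((ℤ.- z) / suc d-1) ∎)

  /-- : ∀ z w d .{{_ : NonZero d}} → z / d - w / d ≡ (z ℤ.- w) / d
  /-- z w d = trans (cong (λ q → z / d + q) (neg-/ w d)) (/-+ z (ℤ.- w) d)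

  /1-* : ∀ h z d .{{_ : NonZero d}} → (h / 1) * (z / d) ≡ (h ℤ.* z) / d
  /1-* h z (suc d-1) = toℚᵘ-injective (begin
    toℚᵘ ((h / 1) * (z / suc d-1))       ≈⟨ toℚᵘ-homo-* (h / 1) (z / suc d-1) ⟩
    toℚᵘ (h / 1) ℚᵘ.* toℚᵘ (z / suc d-1) ≈⟨ ℚᵘ.*-cong (toℚᵘ-/ h 0) (toℚᵘ-/ z d-1) ⟩
    mkℚᵘ h 0 ℚᵘ.* mkℚᵘ z d-1             ≈⟨ *≡* (cong (λ n → (h ℤ.* z) ℤ.* + suc n) (sym (ℕ.+-identityʳ d-1))) ⟩
    mkℚᵘ (h ℤ.* z) d-1                   ≈⟨ toℚᵘ-/ (h ℤ.* z) d-1 ⟨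
    toℚᵘ ((h ℤ.* z) / suc d-1)           ∎)

  /-rescale : ∀ z {d m n} .{{_ : NonZero d}} .{{_ : NonZero n}} → d ℕ.* m ≡ n → z / d ≡ (z ℤ.* + m) / n
  /-rescale z {suc d-1} {m} {suc n-1} dm≡n = toℚᵘ-injective (begin
    toℚᵘ (z / suc d-1)           ≈⟨ toℚᵘ-/ z d-1 ⟩
    mkℚᵘ z d-1                   ≈⟨ *≡* cross-multiplied ⟩
    mkℚᵘ (z ℤ.* + m) n-1         ≈⟨ toℚᵘ-/ (z ℤ.* + m) n-1 ⟨
    toℚᵘ ((z ℤ.* + m) / suc n-1) ∎)
    where
    reassoc : ∀ z d m → z ℤ.* (d ℤ.* m) ≡ (z ℤ.* m) ℤ.* d
    reassoc = solve-∀
    cross-multiplied : z ℤ.* + suc n-1 ≡ (z ℤ.* + m) ℤ.* + suc d-1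
    cross-multiplied = trans (cong (λ n → z ℤ.* + n) (sym dm≡n))
                             (trans (cong (z ℤ.*_) (ℤ.pos-* (suc d-1) m)) (reassoc z (+ suc d-1) (+ m)))

  dy-rescale : ∀ z e f {e′} → e ℕ.+ f ≡ e′ → dy z e ≡ dy (z ℤ.* + 2 ℕ.^ f) e′
  dy-rescale z e f {e′} e+f≡e′ = /-rescale z {{ℕ.m^n≢0 2 e}} {{ℕ.m^n≢0 2 e′}}
    (trans (sym (ℕ.^-distribˡ-+-* 2 e f)) (cong (2 ℕ.^_) e+f≡e′))

  sumℚ-/ : ∀ {A : Set} (xs : List A) f d .{{_ : NonZero d}} → sumℚ (map (λ x → f x / d) xs) ≡ ∑ xs f / d
  sumℚ-/ []       f (suc d-1) = toℚᵘ-injective (ℚᵘ.≃-trans (*≡* refl) (ℚᵘ.≃-sym (toℚᵘ-/ 0ℤ d-1)))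
  sumℚ-/ (x ∷ xs) f d         = trans (cong (λ s → f x / d + s) (sumℚ-/ xs f d)) (/-+ (f x) (∑ xs f) d)

module HaarCoefficient where

  open Sums
  open NatToInt
  open RangeSums
  open Fractions using (/--; /1-*; dy-rescale; sumℚ-/)
  open import Data.Bool using (Bool; true; false; _∧_)
  open import Data.Integer using (ℤ; +_; -_; _+_; _-_; _*_)
  open import Data.Integer.Properties using (+-identityˡ; pos-+; pos-*; *-identityˡ; -1*i≡-i)
  open import Data.Integer.Tactic.RingSolver using (solve-∀)
  open import Data.List using (List; []; _∷_; map; upTo; filter; length)
  open import Data.List.Properties using (map-cong; length-upTo)
  open import Data.Nat as ℕ using (ℕ; suc; _∸_; _≤ᵇ_; _<ᵇ_; _<_; _^_)
  import Data.Nat.Properties as ℕ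
  open import Data.Nat.Tactic.RingSolver using () renaming (solve-∀ to ℕ-solve-∀)
  open import Data.Product using (_×_; _,_; proj₁; proj₂)
  import Data.Rational as ℚ
  open import Relation.Nullary.Decidable using (T?)
  open import Relation.Nullary.Negation using (contradiction)
  open import Relation.Nullary.Reflects using (ofʸ; ofⁿ)
  open import Relation.Binary.PropositionalEquality using (_≡_; refl; sym; trans; cong; cong₂; module ≡-Reasoning)
  open ≡-Reasoning

  haarCol-lower : ∀ k {i} → i < 2 ^ k → haarCol (suc k) i ≡ + 1
  haarCol-lower k {i} i<K with 2 ℕ.* i <ᵇ 2 ^ suc k | ℕ.<ᵇ-reflects-< (2 ℕ.* i) (2 ^ suc k)
  ... | true  | _        = refl
  ... | false | ofⁿ 2i≮N = contradiction (ℕ.*-monoʳ-< 2 i<K) 2i≮N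

  haarCol-upper : ∀ k i → haarCol (suc k) (2 ^ k ℕ.+ i) ≡ - + 1
  haarCol-upper k i with 2 ℕ.* (2 ^ k ℕ.+ i) <ᵇ 2 ^ suc k | ℕ.<ᵇ-reflects-< (2 ℕ.* (2 ^ k ℕ.+ i)) (2 ^ suc k)
  ... | true  | ofʸ 2i<N = contradiction 2i<N (ℕ.≤⇒≯ (ℕ.*-monoʳ-≤ 2 (ℕ.m≤m+n (2 ^ k) i)))
  ... | false | _        = refl

  ∑-haarCol : ∀ k (f : ℕ → ℤ) →
    ∑[ i ∈ upTo (2 ^ suc k) ] haarCol (suc k) i * f i ≡ ∑ (upTo (2 ^ k)) f - (∑[ i ∈ upTo (2 ^ k) ] f (2 ^ k ℕ.+ i))
  ∑-haarCol k f = begin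
    ∑[ i ∈ upTo (2 ^ suc k) ] h i * f i
      ≡⟨ cong (λ n → ∑[ i ∈ upTo (K ℕ.+ n) ] h i * f i) (ℕ.+-identityʳ K) ⟩
    ∑[ i ∈ upTo (K ℕ.+ K) ] h i * f i
      ≡⟨ ∑-upTo-+ K K (λ i → h i * f i) ⟩
    (∑[ i ∈ upTo K ] h i * f i) + (∑[ i ∈ upTo K ] h (K ℕ.+ i) * f (K ℕ.+ i))
      ≡⟨ cong₂ _+_ (∑-upTo-cong K lower) (∑-cong (upTo K) upper) ⟩
    ∑ (upTo K) f + (∑[ i ∈ upTo K ] - f (K ℕ.+ i))
      ≡⟨ cong (λ s → ∑ (upTo K) f + s) (∑-neg (upTo K) (λ i → f (K ℕ.+ i))) ⟩
    ∑ (upTo K) f - (∑[ i ∈ upTo K ] f (K ℕ.+ i)) ∎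
    where
    K = 2 ^ k
    h = haarCol (suc k)
    lower : ∀ i → i < K → h i * f i ≡ f i
    lower i i<K = trans (cong (_* f i) (haarCol-lower k i<K)) (*-identityˡ (f i))
    upper : ∀ i → h (K ℕ.+ i) * f (K ℕ.+ i) ≡ - f (K ℕ.+ i)
    upper i = trans (cong (_* f (K ℕ.+ i)) (haarCol-upper k i)) (-1*i≡-i (f (K ℕ.+ i)))

  ∑-haarCol-odd : ∀ k → ∑[ i ∈ upTo (2 ^ suc k) ] haarCol (suc k) i * + (2 ℕ.* i ℕ.+ 1) ≡ - (+ 2 * (+ 2 ^ k * + 2 ^ k))
  ∑-haarCol-odd k = begin
    ∑[ i ∈ upTo (2 ^ suc k) ] haarCol (suc k) i * + (2 ℕ.* i ℕ.+ 1)
      ≡⟨ ∑-haarCol k (λ i → + (2 ℕ.* i ℕ.+ 1)) ⟩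
    odds - (∑[ i ∈ upTo K ] + (2 ℕ.* (K ℕ.+ i) ℕ.+ 1))
      ≡⟨ cong (λ s → odds - s) (∑-cong (upTo K) shift) ⟩
    odds - (∑[ i ∈ upTo K ] (+ 2 * + K + + (2 ℕ.* i ℕ.+ 1)))
      ≡⟨ cong (λ s → odds - s) (∑-+ (upTo K) (λ _ → + 2 * + K) (λ i → + (2 ℕ.* i ℕ.+ 1))) ⟩
    odds - ((∑[ i ∈ upTo K ] + 2 * + K) + odds)
      ≡⟨ cong₂ (λ o c → o - (c + o)) (∑-upTo-odd K)
               (trans (∑-const (upTo K) (+ 2 * + K)) (cong (λ n → + 2 * + K * + n) (length-upTo K))) ⟩
    + K * + K - (+ 2 * + K * + K + + K * + K)
      ≡⟨ collect (+ K) ⟩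
    - (+ 2 * (+ K * + K)) ∎
    where
    K = 2 ^ k
    odds = ∑[ i ∈ upTo K ] + (2 ℕ.* i ℕ.+ 1)
    shift : ∀ i → + (2 ℕ.* (K ℕ.+ i) ℕ.+ 1) ≡ + 2 * + K + + (2 ℕ.* i ℕ.+ 1)
    shift i = trans (cong +_ (distrib K i)) (trans (pos-+ (2 ℕ.* K) _) (cong (_+ + (2 ℕ.* i ℕ.+ 1)) (pos-* 2 K)))
      where
      distrib : ∀ K i → 2 ℕ.* (K ℕ.+ i) ℕ.+ 1 ≡ 2 ℕ.* K ℕ.+ (2 ℕ.* i ℕ.+ 1)
      distrib = ℕ-solve-∀
    collect : ∀ K → K * K - (+ 2 * K * K + K * K) ≡ - (+ 2 * (K * K))
    collect = solve-∀

  -- 2ⁿ ∫_{X/2ⁿ}^1 h₀,₀ for n = suc k.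
  haarTail : ℕ → ℕ → ℤ
  haarTail k X = ∑[ i ∈ upTo (2 ^ suc k) ] haarCol (suc k) i * + bit (X ≤ᵇ i)

  haarTail-∸ : ∀ k X → haarTail k X ≡ + (2 ^ k ∸ X) - + (2 ^ k ∸ (X ∸ 2 ^ k))
  haarTail-∸ k X = trans (∑-haarCol k (λ i → + bit (X ≤ᵇ i))) (cong₂ _-_ (∑-upTo-≤ᵇ X K) (begin
    ∑[ i ∈ upTo K ] + bit (X ≤ᵇ K ℕ.+ i) ≡⟨ ∑-cong (upTo K) (λ i → cong (λ b → + bit b) (≤ᵇ-+ʳ K X i)) ⟩
    ∑[ i ∈ upTo K ] + bit (X ∸ K ≤ᵇ i)   ≡⟨ ∑-upTo-≤ᵇ (X ∸ K) K ⟩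
    + (K ∸ (X ∸ K))                      ∎))
    where
    K = 2 ^ k

  haarTail-lower : ∀ k {x} → x < 2 ^ k → haarTail k x ≡ - + x
  haarTail-lower k {x} x<K = begin
    haarTail k x                ≡⟨ haarTail-∸ k x ⟩
    + (K ∸ x) - + (K ∸ (x ∸ K)) ≡⟨ cong (λ y → + (K ∸ x) - + (K ∸ y)) (ℕ.m≤n⇒m∸n≡0 (ℕ.<⇒≤ x<K)) ⟩
    + (K ∸ x) - + K             ≡⟨ cong (_- + K) (pos-∸ (ℕ.<⇒≤ x<K)) ⟩
    + K - + x - + K             ≡⟨ cancel (+ K) (+ x) ⟩
    - + x                       ∎
    where
    K = 2 ^ k
    cancel : ∀ K x → K - x - K ≡ - x
    cancel = solve-∀

  haarTail-upper : ∀ k {x} → x < 2 ^ k → haarTail k (x ℕ.+ 2 ^ k) ≡ + x - + 2 ^ k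
  haarTail-upper k {x} x<K = begin
    haarTail k (x ℕ.+ K)
      ≡⟨ haarTail-∸ k (x ℕ.+ K) ⟩
    + (K ∸ (x ℕ.+ K)) - + (K ∸ (x ℕ.+ K ∸ K))
      ≡⟨ cong₂ (λ y z → + y - + (K ∸ z)) (ℕ.m≤n⇒m∸n≡0 (ℕ.m≤n+m K x)) (ℕ.m+n∸n≡m x K) ⟩
    + 0 - + (K ∸ x)
      ≡⟨ cong (λ y → + 0 - y) (pos-∸ (ℕ.<⇒≤ x<K)) ⟩
    + 0 - (+ K - + x)
      ≡⟨ cancel (+ K) (+ x) ⟩
    + x - + K ∎
    where
    K = 2 ^ k
    cancel : ∀ K x → + 0 - (K - x) ≡ x - K
    cancel = solve-∀

  pos-length-filter : ∀ {A : Set} (b : A → Bool) xs → + length (filter (λ x → T? (b x)) xs) ≡ ∑[ x ∈ xs ] + bit (b x)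
  pos-length-filter b []       = refl
  pos-length-filter b (x ∷ xs) with b x
  ... | true  = cong (λ s → + 1 + s) (pos-length-filter b xs)
  ... | false = trans (pos-length-filter b xs) (sym (+-identityˡ _))

  bit-∧ : ∀ x y → + bit (x ∧ y) ≡ + bit x * + bit y
  bit-∧ true  true  = refl
  bit-∧ true  false = refl
  bit-∧ false y     = refl

  ∑-countBelow : ∀ (P : List (ℕ × ℕ)) I J (u : ℕ → ℤ) →
    ∑[ i ∈ I ] ∑[ j ∈ J ] u i * + countBelow P i j
      ≡ ∑[ p ∈ P ] (∑[ i ∈ I ] u i * + bit (proj₁ p ≤ᵇ i)) * (∑[ j ∈ J ] + bit (proj₂ p ≤ᵇ j))
  ∑-countBelow P I J u = begin
    ∑[ i ∈ I ] ∑[ j ∈ J ] u i * + countBelow P i j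
      ≡⟨ ∑-cong I (λ i → ∑-cong J (λ j → by-point i j)) ⟩
    ∑[ i ∈ I ] ∑[ j ∈ J ] ∑[ p ∈ P ] row i p * col j p
      ≡⟨ ∑-cong I (λ i → ∑-comm J P (λ j p → row i p * col j p)) ⟩
    ∑[ i ∈ I ] ∑[ p ∈ P ] ∑[ j ∈ J ] row i p * col j p
      ≡⟨ ∑-comm I P (λ i p → ∑[ j ∈ J ] row i p * col j p) ⟩
    ∑[ p ∈ P ] ∑[ i ∈ I ] ∑[ j ∈ J ] row i p * col j p
      ≡⟨ ∑-cong P (λ p → trans (∑-cong I (λ i → ∑-*ˡ J (row i p) (λ j → col j p)))
                                (∑-*ʳ I (∑[ j ∈ J ] col j p) (λ i → row i p))) ⟩
    ∑[ p ∈ P ] (∑[ i ∈ I ] row i p) * (∑[ j ∈ J ] col j p) ∎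
    where
    row : ℕ → ℕ × ℕ → ℤ
    row i p = u i * + bit (proj₁ p ≤ᵇ i)
    col : ℕ → ℕ × ℕ → ℤ
    col j p = + bit (proj₂ p ≤ᵇ j)
    reassoc : ∀ a b c → a * (b * c) ≡ a * b * c
    reassoc = solve-∀
    by-point : ∀ i j → u i * + countBelow P i j ≡ ∑[ p ∈ P ] row i p * col j p
    by-point i j = begin
      u i * + countBelow P i j
        ≡⟨ cong (u i *_) (pos-length-filter (λ p → (proj₁ p ≤ᵇ i) ∧ (proj₂ p ≤ᵇ j)) P) ⟩
      u i * (∑[ p ∈ P ] + bit ((proj₁ p ≤ᵇ i) ∧ (proj₂ p ≤ᵇ j)))
        ≡⟨ ∑-*ˡ P (u i) _ ⟨
      ∑[ p ∈ P ] u i * + bit ((proj₁ p ≤ᵇ i) ∧ (proj₂ p ≤ᵇ j))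
        ≡⟨ ∑-cong P (λ p → trans (cong (u i *_) (bit-∧ (proj₁ p ≤ᵇ i) (proj₂ p ≤ᵇ j))) (reassoc (u i) _ _)) ⟩
      ∑[ p ∈ P ] row i p * col j p ∎

  haarCoeff≡dy : ∀ n P →
    haarCoeff-0-1-00 n P
      ≡ dy (∑[ i ∈ upTo (2 ^ n) ] ∑[ j ∈ upTo (2 ^ n) ]
              haarCol n i * (+ countBelow P i j * + 2 ^ (n ℕ.+ 2) - + ((2 ℕ.* i ℕ.+ 1) ℕ.* (2 ℕ.* j ℕ.+ 1))))
           (4 ℕ.* n ℕ.+ 2)
  haarCoeff≡dy n P = begin
    haarCoeff-0-1-00 n P
      ≡⟨ cong sumℚ (map-cong (λ i → cong sumℚ (map-cong (cell i) U)) U) ⟩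
    sumℚ (map (λ i → sumℚ (map (λ j → dy (t i j) E) U)) U)
      ≡⟨ cong sumℚ (map-cong (λ i → sumℚ-/ U (t i) (2 ^ E)) U) ⟩
    sumℚ (map (λ i → dy (∑ U (t i)) E) U)
      ≡⟨ sumℚ-/ U (λ i → ∑ U (t i)) (2 ^ E) ⟩
    dy (∑[ i ∈ U ] ∑ U (t i)) E ∎
    where
    U = upTo (2 ^ n)
    E = 4 ℕ.* n ℕ.+ 2
    instance
      2^E≢0 : ℕ.NonZero (2 ^ E)
      2^E≢0 = ℕ.m^n≢0 2 E
    t : ℕ → ℕ → ℤ
    t i j = haarCol n i * (+ countBelow P i j * + 2 ^ (n ℕ.+ 2) - + ((2 ℕ.* i ℕ.+ 1) ℕ.* (2 ℕ.* j ℕ.+ 1)))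
    exponents : ∀ n → 3 ℕ.* n ℕ.+ (n ℕ.+ 2) ≡ 4 ℕ.* n ℕ.+ 2
    exponents = ℕ-solve-∀
    cell : ∀ i j → (haarCol n i ℚ./ 1) ℚ.* cellIntegralΔ n P i j ≡ dy (t i j) E
    cell i j = begin
      (h ℚ./ 1) ℚ.* (dy c (3 ℕ.* n) ℚ.- dy q E)
        ≡⟨ cong (λ x → (h ℚ./ 1) ℚ.* (x ℚ.- dy q E)) (dy-rescale c (3 ℕ.* n) (n ℕ.+ 2) (exponents n)) ⟩
      (h ℚ./ 1) ℚ.* (dy (c * A) E ℚ.- dy q E)
        ≡⟨ cong ((h ℚ./ 1) ℚ.*_) (/-- (c * A) q (2 ^ E)) ⟩
      (h ℚ./ 1) ℚ.* dy (c * A - q) E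
        ≡⟨ /1-* h (c * A - q) (2 ^ E) ⟩
      dy (t i j) E ∎
      where
      h = haarCol n i
      c = + countBelow P i j
      A = + 2 ^ (n ℕ.+ 2)
      q = + ((2 ℕ.* i ℕ.+ 1) ℕ.* (2 ℕ.* j ℕ.+ 1))

  -- 2²ⁿ ∫ h₀,₀(t₁) dt over the quadrant [X/2ⁿ, 1) × [Y/2ⁿ, 1): the t whose box [0, t) contains (X, Y)/2ⁿ.
  cornerIntegral : ℕ → ℕ × ℕ → ℤ
  cornerIntegral k (X , Y) = haarTail k X * + (2 ^ suc k ∸ Y)

  haarCoeff≡dy-cornerIntegral : ∀ k P → let K = + 2 ^ k in
    haarCoeff-0-1-00 (suc k) P ≡ dy (+ 8 * K * ∑ P (cornerIntegral k) + + 8 * (K * K * K * K)) (4 ℕ.* suc k ℕ.+ 2)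
  haarCoeff≡dy-cornerIntegral k P = trans (haarCoeff≡dy (suc k) P) (cong (λ z → dy z (4 ℕ.* suc k ℕ.+ 2)) (begin
    ∑[ i ∈ U ] ∑[ j ∈ U ] h i * (+ countBelow P i j * A - + ((2 ℕ.* i ℕ.+ 1) ℕ.* (2 ℕ.* j ℕ.+ 1)))
      ≡⟨ ∑-cong U (λ i → ∑-cong U (λ j → expand i j)) ⟩
    ∑[ i ∈ U ] ∑[ j ∈ U ] (A * (h i * + countBelow P i j) - h i * odd i * odd j)
      ≡⟨ ∑∑-product U U A (λ i j → h i * + countBelow P i j) (λ i → h i * odd i) odd ⟩
    A * (∑[ i ∈ U ] ∑[ j ∈ U ] h i * + countBelow P i j) - (∑[ i ∈ U ] h i * odd i) * ∑ U odd
      ≡⟨ cong₂ (λ x y → A * x - y) tails (cong₂ _*_ (∑-haarCol-odd k) (∑-upTo-odd N)) ⟩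
    A * S - - (+ 2 * (K * K)) * (+ N * + N)
      ≡⟨ cong₂ (λ a n → a * S - - (+ 2 * (K * K)) * (n * n)) A≡8K (pos-* 2 (2 ^ k)) ⟩
    + 8 * K * S - - (+ 2 * (K * K)) * (+ 2 * K * (+ 2 * K))
      ≡⟨ collect K S ⟩
    + 8 * K * S + + 8 * (K * K * K * K) ∎))
    where
    N = 2 ^ suc k
    U = upTo N
    K = + 2 ^ k
    A = + 2 ^ (suc k ℕ.+ 2)
    h = haarCol (suc k)
    S = ∑ P (cornerIntegral k)
    odd : ℕ → ℤ
    odd i = + (2 ℕ.* i ℕ.+ 1)
    rearrange : ∀ h c A p q → h * (c * A - p * q) ≡ A * (h * c) - h * p * q
    rearrange = solve-∀
    expand : ∀ i j → h i * (+ countBelow P i j * A - + ((2 ℕ.* i ℕ.+ 1) ℕ.* (2 ℕ.* j ℕ.+ 1)))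
                   ≡ A * (h i * + countBelow P i j) - h i * odd i * odd j
    expand i j = trans (cong (λ x → h i * (+ countBelow P i j * A - x)) (pos-* (2 ℕ.* i ℕ.+ 1) (2 ℕ.* j ℕ.+ 1)))
                       (rearrange (h i) (+ countBelow P i j) A (odd i) (odd j))
    tails : ∑[ i ∈ U ] ∑[ j ∈ U ] h i * + countBelow P i j ≡ S
    tails = trans (∑-countBelow P U U h) (∑-cong P (λ p → cong (haarTail k (proj₁ p) *_) (∑-upTo-≤ᵇ (proj₂ p) N)))
    times-8 : ∀ K → + 2 * K * + 4 ≡ + 8 * K
    times-8 = solve-∀
    A≡8K : A ≡ + 8 * K
    A≡8K = trans (pos-2^-+ (suc k) 2) (trans (cong (_* + 4) (pos-* 2 (2 ^ k))) (times-8 K))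
    collect : ∀ K S → + 8 * K * S - - (+ 2 * (K * K)) * (+ 2 * K * (+ 2 * K)) ≡ + 8 * K * S + + 8 * (K * K * K * K)
    collect = solve-∀

module BinaryDigits where

  open Sums
  open import Data.Bool using (Bool; true; false; _xor_)
  open import Data.Integer using (ℤ; 0ℤ; 1ℤ; +_; _+_; _-_; _*_)
  open import Data.Integer.Properties using (pos-+; pos-*; +-commutativeSemigroup)
  open import Algebra.Properties.CommutativeSemigroup +-commutativeSemigroup using (interchange)
  open import Data.Integer.Tactic.RingSolver using (solve-∀)
  open import Data.List as List using (length; _++_)
  open import Data.List.Properties using (length-++; length-map)
  open import Data.Nat as ℕ using (ℕ; zero; suc; _<_; _≤_; _^_)
  import Data.Nat.Properties as ℕ
  open import Data.Nat.Tactic.RingSolver using () renaming (solve-∀ to ℕ-solve-∀)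
  open import Data.Vec using (Vec; []; _∷_; _∷ʳ_; zipWith)
  open import Relation.Binary.PropositionalEquality using (_≡_; refl; sym; trans; cong; cong₂; module ≡-Reasoning)
  open ≡-Reasoning

  infixl 6 _⊕_

  _⊕_ : ∀ {m} → Vec Bool m → Vec Bool m → Vec Bool m
  _⊕_ = zipWith _xor_

  weight : ∀ {m} → Vec Bool m → ℕ
  weight []       = 0
  weight (b ∷ bs) = bit b ℕ.+ weight bs

  bit≤1 : ∀ b → bit b ≤ 1
  bit≤1 false = ℕ.z≤n
  bit≤1 true  = ℕ.≤-refl

  bit-not : ∀ b → + bit (true xor b) ≡ 1ℤ - + bit b
  bit-not false = refl
  bit-not true  = refl

  binLE-∷ʳ : ∀ {m} (v : Vec Bool m) c → binLE (v ∷ʳ c) ≡ binLE v ℕ.+ bit c ℕ.* 2 ^ m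
  binLE-∷ʳ []      c = base (bit c)
    where
    base : ∀ x → x ℕ.+ 2 ℕ.* 0 ≡ 0 ℕ.+ x ℕ.* 1
    base = ℕ-solve-∀
  binLE-∷ʳ {suc m} (b ∷ v) c =
    trans (cong (λ x → bit b ℕ.+ 2 ℕ.* x) (binLE-∷ʳ v c)) (step (bit b) (binLE v) (bit c) (2 ^ m))
    where
    step : ∀ a x y P → a ℕ.+ 2 ℕ.* (x ℕ.+ y ℕ.* P) ≡ a ℕ.+ 2 ℕ.* x ℕ.+ y ℕ.* (2 ℕ.* P)
    step = ℕ-solve-∀

  binBE-∷ʳ : ∀ {m} (w : Vec Bool m) d → binBE (w ∷ʳ d) ≡ 2 ℕ.* binBE w ℕ.+ bit d
  binBE-∷ʳ []      d = base (bit d)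
    where
    base : ∀ x → x ℕ.* 1 ℕ.+ 0 ≡ x
    base = ℕ-solve-∀
  binBE-∷ʳ {suc m} (b ∷ w) d =
    trans (cong (λ x → bit b ℕ.* (2 ℕ.* 2 ^ m) ℕ.+ x) (binBE-∷ʳ w d)) (step (bit b) (2 ^ m) (binBE w) (bit d))
    where
    step : ∀ a P x y → a ℕ.* (2 ℕ.* P) ℕ.+ (2 ℕ.* x ℕ.+ y) ≡ 2 ℕ.* (a ℕ.* P ℕ.+ x) ℕ.+ y
    step = ℕ-solve-∀

  binLE< : ∀ {m} (v : Vec Bool m) → binLE v < 2 ^ m
  binLE< []      = ℕ.s≤s ℕ.z≤n
  binLE< (b ∷ v) = ℕ.≤-trans (ℕ.s≤s (ℕ.+-monoˡ-≤ (2 ℕ.* binLE v) (bit≤1 b)))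
                             (ℕ.≤-trans (ℕ.≤-reflexive (double-suc (binLE v))) (ℕ.*-monoʳ-≤ 2 (binLE< v)))
    where
    double-suc : ∀ x → suc (1 ℕ.+ 2 ℕ.* x) ≡ 2 ℕ.* suc x
    double-suc = ℕ-solve-∀

  binBE< : ∀ {m} (w : Vec Bool m) → binBE w < 2 ^ m
  binBE< []              = ℕ.s≤s ℕ.z≤n
  binBE< {suc m} (b ∷ w) = ℕ.≤-trans (ℕ.≤-reflexive (sym (ℕ.+-suc (bit b ℕ.* P) (binBE w))))
    (ℕ.+-mono-≤ (ℕ.≤-trans (ℕ.*-monoˡ-≤ P (bit≤1 b)) (ℕ.≤-reflexive (ℕ.+-identityʳ P)))
                (ℕ.≤-trans (binBE< w) (ℕ.≤-reflexive (sym (ℕ.+-identityʳ P)))))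
    where
    P = 2 ^ m

  pos-binLE-∷ : ∀ {m} b (v : Vec Bool m) → + binLE (b ∷ v) ≡ + bit b + + 2 * + binLE v
  pos-binLE-∷ b v = trans (pos-+ (bit b) _) (cong (λ x → + bit b + x) (pos-* 2 (binLE v)))

  pos-binBE-∷ : ∀ {m} b (w : Vec Bool m) → + binBE (b ∷ w) ≡ + bit b * + 2 ^ m + + binBE w
  pos-binBE-∷ {m} b w = trans (pos-+ _ (binBE w)) (cong (_+ + binBE w) (pos-* (bit b) (2 ^ m)))

  length-allVecs : ∀ m → length (allVecs m) ≡ 2 ^ m
  length-allVecs zero    = refl
  length-allVecs (suc m) = begin
    length (List.map (false ∷_) (allVecs m) ++ List.map (true ∷_) (allVecs m))
      ≡⟨ length-++ (List.map (false ∷_) (allVecs m)) ⟩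
    length (List.map (false ∷_) (allVecs m)) ℕ.+ length (List.map (true ∷_) (allVecs m))
      ≡⟨ cong₂ ℕ._+_ (length-map (false ∷_) (allVecs m)) (length-map (true ∷_) (allVecs m)) ⟩
    length (allVecs m) ℕ.+ length (allVecs m)
      ≡⟨ cong (λ n → n ℕ.+ n) (length-allVecs m) ⟩
    2 ^ m ℕ.+ 2 ^ m
      ≡⟨ cong (2 ^ m ℕ.+_) (ℕ.+-identityʳ (2 ^ m)) ⟨
    2 ^ suc m ∎

  ∑-allVecs-∷ : ∀ m (g : Vec Bool (suc m) → ℤ) →
    ∑ (allVecs (suc m)) g ≡ (∑[ v ∈ allVecs m ] g (false ∷ v)) + (∑[ v ∈ allVecs m ] g (true ∷ v))
  ∑-allVecs-∷ m g = trans (∑-++ (List.map (false ∷_) (allVecs m)) _ g)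
                          (cong₂ _+_ (∑-map (false ∷_) (allVecs m) g) (∑-map (true ∷_) (allVecs m) g))

  ∑-allVecs-∷ʳ : ∀ m (g : Vec Bool (suc m) → ℤ) →
    ∑ (allVecs (suc m)) g ≡ (∑[ v ∈ allVecs m ] g (v ∷ʳ false)) + (∑[ v ∈ allVecs m ] g (v ∷ʳ true))
  ∑-allVecs-∷ʳ zero    g = pad (g (false ∷ [])) (g (true ∷ []))
    where
    pad : ∀ a b → a + (b + 0ℤ) ≡ (a + 0ℤ) + (b + 0ℤ)
    pad = solve-∀
  ∑-allVecs-∷ʳ (suc m) g = begin
    ∑ (allVecs (suc (suc m))) g
      ≡⟨ ∑-allVecs-∷ (suc m) g ⟩
    ∑ (allVecs (suc m)) (λ v → g (false ∷ v)) + ∑ (allVecs (suc m)) (λ v → g (true ∷ v))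
      ≡⟨ cong₂ _+_ (∑-allVecs-∷ʳ m (λ v → g (false ∷ v))) (∑-allVecs-∷ʳ m (λ v → g (true ∷ v))) ⟩
    (S false false + S false true) + (S true false + S true true)
      ≡⟨ interchange (S false false) (S false true) (S true false) (S true true) ⟩
    (S false false + S true false) + (S false true + S true true)
      ≡⟨ cong₂ _+_ (∑-allVecs-∷ m (λ v → g (v ∷ʳ false))) (∑-allVecs-∷ m (λ v → g (v ∷ʳ true))) ⟨
    ∑ (allVecs (suc m)) (λ v → g (v ∷ʳ false)) + ∑ (allVecs (suc m)) (λ v → g (v ∷ʳ true)) ∎
    where
    S : Bool → Bool → ℤ
    S b c = ∑[ v ∈ allVecs m ] g (b ∷ (v ∷ʳ c))

  ∑-binLE : ∀ m → let K = + 2 ^ m in + 2 * (∑[ v ∈ allVecs m ] + binLE v) ≡ K * K - K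
  ∑-binLE zero    = refl
  ∑-binLE (suc m) = begin
    + 2 * (∑[ v ∈ allVecs (suc m) ] + binLE v)
      ≡⟨ cong (λ s → + 2 * s) (trans (∑-allVecs-∷ m _) (cong₂ _+_ (half false) (half true))) ⟩
    + 2 * ((+ 0 * N + + 2 * X) + (+ 1 * N + + 2 * X))
      ≡⟨ regroup N X ⟩
    + 2 * N + + 4 * (+ 2 * X)
      ≡⟨ cong₂ (λ n x → + 2 * n + + 4 * x) (cong +_ (length-allVecs m)) (∑-binLE m) ⟩
    + 2 * K + + 4 * (K * K - K)
      ≡⟨ double K ⟩
    + 2 * K * (+ 2 * K) - + 2 * K
      ≡⟨ cong (λ K′ → K′ * K′ - K′) (pos-* 2 (2 ^ m)) ⟨
    + 2 ^ suc m * + 2 ^ suc m - + 2 ^ suc m ∎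
    where
    K = + 2 ^ m
    N = + length (allVecs m)
    X = ∑[ v ∈ allVecs m ] + binLE v
    half : ∀ b → ∑[ v ∈ allVecs m ] + binLE (b ∷ v) ≡ + bit b * N + + 2 * X
    half b = trans (∑-cong (allVecs m) (pos-binLE-∷ b)) (∑-affine (allVecs m) (+ bit b) (+ 2) (λ v → + binLE v))
    regroup : ∀ N X → + 2 * ((+ 0 * N + + 2 * X) + (+ 1 * N + + 2 * X)) ≡ + 2 * N + + 4 * (+ 2 * X)
    regroup = solve-∀
    double : ∀ K → + 2 * K + + 4 * (K * K - K) ≡ + 2 * K * (+ 2 * K) - + 2 * K
    double = solve-∀

  ∑-binBE-⊕ : ∀ m (e : Vec Bool m) → let K = + 2 ^ m in + 2 * (∑[ v ∈ allVecs m ] + binBE (v ⊕ e)) ≡ K * K - K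
  ∑-binBE-⊕ zero    []       = refl
  ∑-binBE-⊕ (suc m) (e₁ ∷ e) = begin
    + 2 * (∑[ v ∈ allVecs (suc m) ] + binBE (v ⊕ (e₁ ∷ e)))
      ≡⟨ cong (λ s → + 2 * s) (trans (∑-allVecs-∷ m _) (cong₂ _+_ (half false) (half true))) ⟩
    + 2 * ((d * K * N + Z) + (+ bit (true xor e₁) * K * N + Z))
      ≡⟨ cong₂ (λ b n → + 2 * ((d * K * n + Z) + (b * K * n + Z))) (bit-not e₁) (cong +_ (length-allVecs m)) ⟩
    + 2 * ((d * K * K + Z) + ((1ℤ - d) * K * K + Z))
      ≡⟨ regroup d K Z ⟩
    + 2 * (K * K) + + 2 * (+ 2 * Z)
      ≡⟨ cong (λ z → + 2 * (K * K) + + 2 * z) (∑-binBE-⊕ m e) ⟩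
    + 2 * (K * K) + + 2 * (K * K - K)
      ≡⟨ double K ⟩
    + 2 * K * (+ 2 * K) - + 2 * K
      ≡⟨ cong (λ K′ → K′ * K′ - K′) (pos-* 2 (2 ^ m)) ⟨
    + 2 ^ suc m * + 2 ^ suc m - + 2 ^ suc m ∎
    where
    K = + 2 ^ m
    N = + length (allVecs m)
    Z = ∑[ v ∈ allVecs m ] + binBE (v ⊕ e)
    d = + bit e₁
    half : ∀ b → ∑[ v ∈ allVecs m ] + binBE ((b ∷ v) ⊕ (e₁ ∷ e)) ≡ + bit (b xor e₁) * K * N + Z
    half b = trans (∑-cong (allVecs m) (λ v → pos-binBE-∷ (b xor e₁) (v ⊕ e)))
                   (trans (∑-+ (allVecs m) (λ _ → + bit (b xor e₁) * K) (λ v → + binBE (v ⊕ e)))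
                          (cong (_+ Z) (∑-const (allVecs m) (+ bit (b xor e₁) * K))))
    regroup : ∀ d K Z → + 2 * ((d * K * K + Z) + ((1ℤ - d) * K * K + Z)) ≡ + 2 * (K * K) + + 2 * (+ 2 * Z)
    regroup = solve-∀
    double : ∀ K → + 2 * (K * K) + + 2 * (K * K - K) ≡ + 2 * K * (+ 2 * K) - + 2 * K
    double = solve-∀

  ∑-binLE*binBE-⊕-∷ : ∀ m b e₁ (e : Vec Bool m) → let K = + 2 ^ m in let β = + bit (b xor e₁) in
    ∑[ v ∈ allVecs m ] + binLE (b ∷ v) * + binBE ((b ∷ v) ⊕ (e₁ ∷ e))
      ≡ + bit b * β * K * K + + 2 * β * K * (∑[ v ∈ allVecs m ] + binLE v)
        + + bit b * (∑[ v ∈ allVecs m ] + binBE (v ⊕ e)) + + 2 * (∑[ v ∈ allVecs m ] + binLE v * + binBE (v ⊕ e))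
  ∑-binLE*binBE-⊕-∷ m b e₁ e = begin
    ∑[ v ∈ allVecs m ] + binLE (b ∷ v) * + binBE ((b ∷ v) ⊕ (e₁ ∷ e))
      ≡⟨ ∑-cong (allVecs m) (λ v → cong₂ _*_ (pos-binLE-∷ b v) (pos-binBE-∷ (b xor e₁) (v ⊕ e))) ⟩
    ∑[ v ∈ allVecs m ] (+ bit b + + 2 * x v) * (β * K + z v)
      ≡⟨ ∑-cong (allVecs m) (λ v → expand (+ bit b) β K (x v) (z v)) ⟩
    ∑[ v ∈ allVecs m ] (+ bit b * β * K + + 2 * β * K * x v + + bit b * z v + + 2 * (x v * z v))
      ≡⟨ ∑-bilinear (allVecs m) (+ bit b * β * K) (+ 2 * β * K) (+ bit b) (+ 2) x z ⟩
    + bit b * β * K * + length (allVecs m) + + 2 * β * K * ∑ (allVecs m) x + + bit b * ∑ (allVecs m) z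
      + + 2 * (∑[ v ∈ allVecs m ] x v * z v)
      ≡⟨ cong (λ n → + bit b * β * K * + n + + 2 * β * K * ∑ (allVecs m) x + + bit b * ∑ (allVecs m) z
                      + + 2 * (∑[ v ∈ allVecs m ] x v * z v)) (length-allVecs m) ⟩
    + bit b * β * K * K + + 2 * β * K * ∑ (allVecs m) x + + bit b * ∑ (allVecs m) z
      + + 2 * (∑[ v ∈ allVecs m ] x v * z v) ∎
    where
    K = + 2 ^ m
    β = + bit (b xor e₁)
    x : Vec Bool m → ℤ
    x v = + binLE v
    z : Vec Bool m → ℤ
    z v = + binBE (v ⊕ e)
    expand : ∀ b β K x z → (b + + 2 * x) * (β * K + z) ≡ b * β * K + + 2 * β * K * x + b * z + + 2 * (x * z)
    expand = solve-∀

  -- Off the diagonal, bits of v and of v ⊕ e are independent; on it vᵢ(vᵢ ⊕ eᵢ) vanishes exactly when eᵢ = 1.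
  ∑-binLE*binBE-⊕ : ∀ m (e : Vec Bool m) → let K = + 2 ^ m in
    + 8 * (∑[ v ∈ allVecs m ] + binLE v * + binBE (v ⊕ e))
      ≡ + 2 * K * ((K - 1ℤ) * (K - 1ℤ)) + + m * (K * K) - + 2 * (K * K) * + weight e
  ∑-binLE*binBE-⊕ zero    []       = refl
  ∑-binLE*binBE-⊕ (suc m) (e₁ ∷ e) = begin
    + 8 * (∑[ v ∈ allVecs (suc m) ] + binLE v * + binBE (v ⊕ (e₁ ∷ e)))
      ≡⟨ cong (λ s → + 8 * s) (trans (∑-allVecs-∷ m _)
                                     (cong₂ _+_ (∑-binLE*binBE-⊕-∷ m false e₁ e) (∑-binLE*binBE-⊕-∷ m true e₁ e))) ⟩
    + 8 * ((+ 0 * d * K * K + + 2 * d * K * X + + 0 * Z + + 2 * F)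
           + (+ 1 * d₁ * K * K + + 2 * d₁ * K * X + + 1 * Z + + 2 * F))
      ≡⟨ regroup d d₁ K X Z F ⟩
    moments d₁ (+ 2 * X) (+ 2 * Z) (+ 8 * F)
      ≡⟨ cong (λ b → moments b (+ 2 * X) (+ 2 * Z) (+ 8 * F)) (bit-not e₁) ⟩
    moments (1ℤ - d) (+ 2 * X) (+ 2 * Z) (+ 8 * F)
      ≡⟨ cong₂ (λ x z → moments (1ℤ - d) x z (+ 8 * F)) (∑-binLE m) (∑-binBE-⊕ m e) ⟩
    moments (1ℤ - d) (K * K - K) (K * K - K) (+ 8 * F)
      ≡⟨ cong (moments (1ℤ - d) (K * K - K) (K * K - K)) (∑-binLE*binBE-⊕ m e) ⟩
    moments (1ℤ - d) (K * K - K) (K * K - K) (+ 2 * K * ((K - 1ℤ) * (K - 1ℤ)) + + m * (K * K) - + 2 * (K * K) * + weight e)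
      ≡⟨ closed-form d K (+ m) (+ weight e) ⟩
    + 2 * (+ 2 * K) * ((+ 2 * K - 1ℤ) * (+ 2 * K - 1ℤ)) + (1ℤ + + m) * (+ 2 * K * (+ 2 * K))
      - + 2 * (+ 2 * K * (+ 2 * K)) * (d + + weight e)
      ≡⟨ cong₂ (λ K′ w → + 2 * K′ * ((K′ - 1ℤ) * (K′ - 1ℤ)) + + suc m * (K′ * K′) - + 2 * (K′ * K′) * w)
               (pos-* 2 (2 ^ m)) (pos-+ (bit e₁) (weight e)) ⟨
    + 2 * K′ * ((K′ - 1ℤ) * (K′ - 1ℤ)) + + suc m * (K′ * K′) - + 2 * (K′ * K′) * + weight (e₁ ∷ e) ∎
    where
    K  = + 2 ^ m
    K′ = + 2 ^ suc m
    d  = + bit e₁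
    d₁ = + bit (true xor e₁)
    X  = ∑[ v ∈ allVecs m ] + binLE v
    Z  = ∑[ v ∈ allVecs m ] + binBE (v ⊕ e)
    F  = ∑[ v ∈ allVecs m ] + binLE v * + binBE (v ⊕ e)
    moments : ℤ → ℤ → ℤ → ℤ → ℤ
    moments b X₂ Z₂ F₈ = + 8 * b * (K * K) + + 8 * (d + b) * K * X₂ + + 4 * Z₂ + + 4 * F₈
    regroup : ∀ d d₁ K X Z F →
      + 8 * ((+ 0 * d * K * K + + 2 * d * K * X + + 0 * Z + + 2 * F)
             + (+ 1 * d₁ * K * K + + 2 * d₁ * K * X + + 1 * Z + + 2 * F))
        ≡ + 8 * d₁ * (K * K) + + 8 * (d + d₁) * K * (+ 2 * X) + + 4 * (+ 2 * Z) + + 4 * (+ 8 * F)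
    regroup = solve-∀
    closed-form : ∀ d K m w →
      + 8 * (1ℤ - d) * (K * K) + + 8 * (d + (1ℤ - d)) * K * (K * K - K) + + 4 * (K * K - K)
        + + 4 * (+ 2 * K * ((K - 1ℤ) * (K - 1ℤ)) + m * (K * K) - + 2 * (K * K) * w)
        ≡ + 2 * (+ 2 * K) * ((+ 2 * K - 1ℤ) * (+ 2 * K - 1ℤ)) + (1ℤ + m) * (+ 2 * K * (+ 2 * K))
          - + 2 * (+ 2 * K * (+ 2 * K)) * (d + w)
    closed-form = solve-∀

  -- The number of grid rows j < 2^{m+1} with j ≥ 2·binBE (v ⊕ e) + d.
  gap : ∀ {m} → Vec Bool m → ℤ → Vec Bool m → ℤ
  gap {m} e d v = + 2 * + 2 ^ m - + 2 * + binBE (v ⊕ e) - d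

  ∑-gap : ∀ m (e : Vec Bool m) d → let K = + 2 ^ m in ∑ (allVecs m) (gap e d) ≡ K * K + (1ℤ - d) * K
  ∑-gap m e d = begin
    ∑[ v ∈ allVecs m ] (+ 2 * K - + 2 * + binBE (v ⊕ e) - d)
      ≡⟨ ∑-cong (allVecs m) (λ v → reorder K d (+ binBE (v ⊕ e))) ⟩
    ∑[ v ∈ allVecs m ] (+ 2 * K - d - + 2 * + binBE (v ⊕ e))
      ≡⟨ ∑-- (allVecs m) (λ _ → + 2 * K - d) (λ v → + 2 * + binBE (v ⊕ e)) ⟩
    (∑[ v ∈ allVecs m ] (+ 2 * K - d)) - (∑[ v ∈ allVecs m ] + 2 * + binBE (v ⊕ e))
      ≡⟨ cong₂ _-_ (∑-const (allVecs m) (+ 2 * K - d)) (∑-*ˡ (allVecs m) (+ 2) (λ v → + binBE (v ⊕ e))) ⟩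
    (+ 2 * K - d) * + length (allVecs m) - + 2 * (∑[ v ∈ allVecs m ] + binBE (v ⊕ e))
      ≡⟨ cong₂ (λ n z → (+ 2 * K - d) * + n - z) (length-allVecs m) (∑-binBE-⊕ m e) ⟩
    (+ 2 * K - d) * K - (K * K - K)
      ≡⟨ collect K d ⟩
    K * K + (1ℤ - d) * K ∎
    where
    K = + 2 ^ m
    reorder : ∀ K d z → + 2 * K - + 2 * z - d ≡ + 2 * K - d - + 2 * z
    reorder = solve-∀
    collect : ∀ K d → (+ 2 * K - d) * K - (K * K - K) ≡ K * K + (1ℤ - d) * K
    collect = solve-∀

  ∑-binLE*gap : ∀ m (e : Vec Bool m) d → let K = + 2 ^ m in
    + 8 * (∑[ v ∈ allVecs m ] + binLE v * gap e d v)
      ≡ + 4 * K * (K - 1ℤ) * (K + 1ℤ - d) - + 2 * + m * (K * K) + + 4 * (K * K) * + weight e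
  ∑-binLE*gap m e d = begin
    + 8 * (∑[ v ∈ allVecs m ] x v * (+ 2 * K - + 2 * z v - d))
      ≡⟨ cong (λ s → + 8 * s) (∑-cong (allVecs m) (λ v → distribute K d (x v) (z v))) ⟩
    + 8 * (∑[ v ∈ allVecs m ] ((+ 2 * K - d) * x v - + 2 * (x v * z v)))
      ≡⟨ cong (λ s → + 8 * s) (∑-- (allVecs m) (λ v → (+ 2 * K - d) * x v) (λ v → + 2 * (x v * z v))) ⟩
    + 8 * ((∑[ v ∈ allVecs m ] (+ 2 * K - d) * x v) - (∑[ v ∈ allVecs m ] + 2 * (x v * z v)))
      ≡⟨ cong₂ (λ p q → + 8 * (p - q)) (∑-*ˡ (allVecs m) (+ 2 * K - d) x) (∑-*ˡ (allVecs m) (+ 2) (λ v → x v * z v)) ⟩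
    + 8 * ((+ 2 * K - d) * ∑ (allVecs m) x - + 2 * (∑[ v ∈ allVecs m ] x v * z v))
      ≡⟨ regroup (+ 2 * K - d) (∑ (allVecs m) x) (∑[ v ∈ allVecs m ] x v * z v) ⟩
    + 4 * (+ 2 * K - d) * (+ 2 * ∑ (allVecs m) x) - + 2 * (+ 8 * (∑[ v ∈ allVecs m ] x v * z v))
      ≡⟨ cong₂ (λ p q → + 4 * (+ 2 * K - d) * p - + 2 * q) (∑-binLE m) (∑-binLE*binBE-⊕ m e) ⟩
    + 4 * (+ 2 * K - d) * (K * K - K) - + 2 * (+ 2 * K * ((K - 1ℤ) * (K - 1ℤ)) + + m * (K * K) - + 2 * (K * K) * + weight e)
      ≡⟨ collect K d (+ m) (+ weight e) ⟩
    + 4 * K * (K - 1ℤ) * (K + 1ℤ - d) - + 2 * + m * (K * K) + + 4 * (K * K) * + weight e ∎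
    where
    K = + 2 ^ m
    x : Vec Bool m → ℤ
    x v = + binLE v
    z : Vec Bool m → ℤ
    z v = + binBE (v ⊕ e)
    distribute : ∀ K d x z → x * (+ 2 * K - + 2 * z - d) ≡ (+ 2 * K - d) * x - + 2 * (x * z)
    distribute = solve-∀
    regroup : ∀ c X F → + 8 * (c * X - + 2 * F) ≡ + 4 * c * (+ 2 * X) - + 2 * (+ 8 * F)
    regroup = solve-∀
    collect : ∀ K d m w →
      + 4 * (+ 2 * K - d) * (K * K - K) - + 2 * (+ 2 * K * ((K - 1ℤ) * (K - 1ℤ)) + m * (K * K) - + 2 * (K * K) * w)
        ≡ + 4 * K * (K - 1ℤ) * (K + 1ℤ - d) - + 2 * m * (K * K) + + 4 * (K * K) * w
    collect = solve-∀

module PointSet where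

  open Sums
  open NatToInt using (pos-∸)
  open HaarCoefficient using (haarTail; haarTail-lower; haarTail-upper; cornerIntegral; haarCoeff≡dy-cornerIntegral)
  open BinaryDigits
  open import Data.Bool using (Bool; true; false; _xor_; _∧_)
  open import Data.Bool.Properties using (xor-assoc)
  open import Data.Integer using (ℤ; 1ℤ; +_; -_; _+_; _-_; _*_)
  open import Data.Integer.Properties using (pos-+; pos-*; neg-distribˡ-*)
  open import Data.Integer.Tactic.RingSolver using (solve-∀)
  open import Data.Nat as ℕ using (ℕ; suc; _∸_; _≤_; _^_)
  import Data.Nat.Properties as ℕ
  open import Data.Nat.Tactic.RingSolver using () renaming (solve-∀ to ℕ-solve-∀)
  open import Data.Product using (_,_)
  open import Data.Vec using (Vec; []; _∷_; _∷ʳ_; map; zipWith; init; last)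
  open import Data.Vec.Properties using (init-∷ʳ; last-∷ʳ; zipWith-assoc)
  open import Relation.Binary.PropositionalEquality using (_≡_; refl; trans; cong; cong₂; module ≡-Reasoning)
  open ≡-Reasoning

  Lsum-weight : ∀ {m} (a s : Vec Bool m) → Lsum a s ≡ + weight (map (_∧ true) a ⊕ s) - + weight (map (_∧ false) a ⊕ s)
  Lsum-weight []       []       = refl
  Lsum-weight (a₁ ∷ a) (s₁ ∷ s) = begin
    + bit a₁ * (+ 1 - + 2 * + bit s₁) + Lsum a s ≡⟨ cong₂ _+_ (digit a₁ s₁) (Lsum-weight a s) ⟩
    (+ b₁ - + b₀) + (+ w₁ - + w₀)                ≡⟨ regroup (+ b₁) (+ b₀) (+ w₁) (+ w₀) ⟩
    (+ b₁ + + w₁) - (+ b₀ + + w₀)                ≡⟨ cong₂ _-_ (pos-+ b₁ w₁) (pos-+ b₀ w₀) ⟨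
    + (b₁ ℕ.+ w₁) - + (b₀ ℕ.+ w₀)                ∎
    where
    b₁ = bit (a₁ ∧ true xor s₁)
    b₀ = bit (a₁ ∧ false xor s₁)
    w₁ = weight (map (_∧ true) a ⊕ s)
    w₀ = weight (map (_∧ false) a ⊕ s)
    digit : ∀ a s → + bit a * (+ 1 - + 2 * + bit s) ≡ + bit (a ∧ true xor s) - + bit (a ∧ false xor s)
    digit true  true  = refl
    digit true  false = refl
    digit false true  = refl
    digit false false = refl
    regroup : ∀ x y X Y → (x - y) + (X - Y) ≡ (x + X) - (y + Y)
    regroup = solve-∀

  module _ {k : ℕ} (a : Vec Bool k) (σ : Vec Bool (suc k)) where

    digitShift : Bool → Vec Bool k
    digitShift c = map (_∧ c) a ⊕ init σ

    lastDigit : Bool → ℕ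
    lastDigit c = bit (c xor last σ)

    ordinate : Bool → Vec Bool k → ℕ
    ordinate c v = 2 ℕ.* binBE (v ⊕ digitShift c) ℕ.+ lastDigit c

    bDigits-∷ʳ : ∀ v c → bDigits a σ (v ∷ʳ c) ≡ (v ⊕ digitShift c) ∷ʳ (c xor last σ)
    bDigits-∷ʳ v c = trans
      (cong₂ (λ t c′ → zipWith _xor_ (zipWith _xor_ t (map (_∧ c′) a)) (init σ) ∷ʳ (c′ xor last σ))
             (init-∷ʳ c v) (last-∷ʳ c v))
      (cong (_∷ʳ (c xor last σ)) (zipWith-assoc xor-assoc v (map (_∧ c) a) (init σ)))

    point-∷ʳ : ∀ v c → point a σ (v ∷ʳ c) ≡ (binLE v ℕ.+ bit c ℕ.* 2 ^ k , ordinate c v)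
    point-∷ʳ v c = cong₂ _,_ (binLE-∷ʳ v c) (trans (cong binBE (bDigits-∷ʳ v c)) (binBE-∷ʳ (v ⊕ digitShift c) _))

    pos-∸-ordinate : ∀ c v → + (2 ^ suc k ∸ ordinate c v) ≡ gap (digitShift c) (+ lastDigit c) v
    pos-∸-ordinate c v = begin
      + (2 ^ suc k ∸ (2 ℕ.* z ℕ.+ d))
        ≡⟨ pos-∸ Y≤N ⟩
      + 2 ^ suc k - + (2 ℕ.* z ℕ.+ d)
        ≡⟨ cong₂ _-_ (pos-* 2 (2 ^ k)) (trans (pos-+ (2 ℕ.* z) d) (cong (_+ + d) (pos-* 2 z))) ⟩
      + 2 * + 2 ^ k - (+ 2 * + z + + d)
        ≡⟨ reassoc (+ 2 * + 2 ^ k) (+ 2 * + z) (+ d) ⟩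
      gap (digitShift c) (+ d) v ∎
      where
      z = binBE (v ⊕ digitShift c)
      d = lastDigit c
      double-suc : ∀ z → suc (2 ℕ.* z ℕ.+ 1) ≡ 2 ℕ.* suc z
      double-suc = ℕ-solve-∀
      Y≤N : 2 ℕ.* z ℕ.+ d ≤ 2 ^ suc k
      Y≤N = ℕ.≤-trans (ℕ.+-monoʳ-≤ (2 ℕ.* z) (bit≤1 (c xor last σ)))
              (ℕ.≤-trans (ℕ.≤-trans (ℕ.n≤1+n _) (ℕ.≤-reflexive (double-suc z)))
                         (ℕ.*-monoʳ-≤ 2 (binBE< (v ⊕ digitShift c))))
      reassoc : ∀ a b c → a - (b + c) ≡ a - b - c
      reassoc = solve-∀

    rows : Bool → Vec Bool k → ℤ
    rows c = gap (digitShift c) (+ lastDigit c)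

    cornerIntegral-false : ∀ v → cornerIntegral k (point a σ (v ∷ʳ false)) ≡ - (+ binLE v * rows false v)
    cornerIntegral-false v = begin
      cornerIntegral k (point a σ (v ∷ʳ false))
        ≡⟨ cong (cornerIntegral k) (point-∷ʳ v false) ⟩
      haarTail k (binLE v ℕ.+ 0) * + (2 ^ suc k ∸ ordinate false v)
        ≡⟨ cong₂ _*_ (trans (cong (haarTail k) (ℕ.+-identityʳ (binLE v))) (haarTail-lower k (binLE< v)))
                     (pos-∸-ordinate false v) ⟩
      - + binLE v * rows false v
        ≡⟨ neg-distribˡ-* (+ binLE v) (rows false v) ⟨
      - (+ binLE v * rows false v) ∎

    cornerIntegral-true : ∀ v → cornerIntegral k (point a σ (v ∷ʳ true)) ≡ + binLE v * rows true v - + 2 ^ k * rows true v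
    cornerIntegral-true v = begin
      cornerIntegral k (point a σ (v ∷ʳ true))
        ≡⟨ cong (cornerIntegral k) (point-∷ʳ v true) ⟩
      haarTail k (binLE v ℕ.+ 1 ℕ.* 2 ^ k) * + (2 ^ suc k ∸ ordinate true v)
        ≡⟨ cong₂ _*_ (trans (cong (λ K → haarTail k (binLE v ℕ.+ K)) (ℕ.*-identityˡ (2 ^ k))) (haarTail-upper k (binLE< v)))
                     (pos-∸-ordinate true v) ⟩
      (+ binLE v - + 2 ^ k) * rows true v
        ≡⟨ distrib (+ binLE v) (+ 2 ^ k) (rows true v) ⟩
      + binLE v * rows true v - + 2 ^ k * rows true v ∎
      where
      distrib : ∀ x K g → (x - K) * g ≡ x * g - K * g
      distrib = solve-∀

    ∑-cornerIntegral-split : ∑ (pointSet a σ) (cornerIntegral k)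
      ≡ - (∑[ v ∈ allVecs k ] + binLE v * rows false v)
        + ((∑[ v ∈ allVecs k ] + binLE v * rows true v) - + 2 ^ k * ∑ (allVecs k) (rows true))
    ∑-cornerIntegral-split = begin
      ∑ (pointSet a σ) (cornerIntegral k)
        ≡⟨ trans (∑-map (point a σ) (allVecs (suc k)) (cornerIntegral k))
                 (∑-allVecs-∷ʳ k (λ t → cornerIntegral k (point a σ t))) ⟩
      (∑[ v ∈ allVecs k ] cornerIntegral k (point a σ (v ∷ʳ false)))
        + (∑[ v ∈ allVecs k ] cornerIntegral k (point a σ (v ∷ʳ true)))
        ≡⟨ cong₂ _+_ (∑-cong (allVecs k) cornerIntegral-false) (∑-cong (allVecs k) cornerIntegral-true) ⟩
      (∑[ v ∈ allVecs k ] - (x v * rows false v)) + (∑[ v ∈ allVecs k ] (x v * rows true v - K * rows true v))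
        ≡⟨ cong₂ _+_ (∑-neg (allVecs k) (λ v → x v * rows false v))
                     (∑-- (allVecs k) (λ v → x v * rows true v) (λ v → K * rows true v)) ⟩
      - (∑[ v ∈ allVecs k ] x v * rows false v)
        + ((∑[ v ∈ allVecs k ] x v * rows true v) - (∑[ v ∈ allVecs k ] K * rows true v))
        ≡⟨ cong (λ u → - (∑[ v ∈ allVecs k ] x v * rows false v) + ((∑[ v ∈ allVecs k ] x v * rows true v) - u))
                (∑-*ˡ (allVecs k) K (rows true)) ⟩
      - (∑[ v ∈ allVecs k ] x v * rows false v)
        + ((∑[ v ∈ allVecs k ] x v * rows true v) - K * ∑ (allVecs k) (rows true)) ∎
      where
      K = + 2 ^ k
      x : Vec Bool k → ℤ
      x v = + binLE v

    ∑-cornerIntegral : let K = + 2 ^ k in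
      + 8 * ∑ (pointSet a σ) (cornerIntegral k)
        ≡ - (+ 8 * (K * K * K)) + + 4 * (K * K) * (Lsum a (init σ) - 1ℤ) + + 4 * K * (1ℤ - + 2 * + bit (last σ))
    ∑-cornerIntegral = begin
      + 8 * ∑ (pointSet a σ) (cornerIntegral k)
        ≡⟨ cong (λ s → + 8 * s) ∑-cornerIntegral-split ⟩
      + 8 * (- P false + (P true - K * ∑ (allVecs k) (rows true)))
        ≡⟨ regroup (P false) (P true) K (∑ (allVecs k) (rows true)) ⟩
      - (+ 8 * P false) + + 8 * P true - + 8 * K * ∑ (allVecs k) (rows true)
        ≡⟨ cong₂ (λ p u → - (+ 8 * P false) + p - + 8 * K * u)
                 (∑-binLE*gap k (digitShift true) d₁) (∑-gap k (digitShift true) d₁) ⟩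
      - (+ 8 * P false) + moment d₁ w₁ - + 8 * K * (K * K + (1ℤ - d₁) * K)
        ≡⟨ cong (λ p → - p + moment d₁ w₁ - + 8 * K * (K * K + (1ℤ - d₁) * K)) (∑-binLE*gap k (digitShift false) d) ⟩
      - moment d w₀ + moment d₁ w₁ - + 8 * K * (K * K + (1ℤ - d₁) * K)
        ≡⟨ cong (λ d₁ → - moment d w₀ + moment d₁ w₁ - + 8 * K * (K * K + (1ℤ - d₁) * K)) (bit-not (last σ)) ⟩
      - moment d w₀ + moment (1ℤ - d) w₁ - + 8 * K * (K * K + (1ℤ - (1ℤ - d)) * K)
        ≡⟨ collect K d (+ k) w₀ w₁ ⟩
      - (+ 8 * (K * K * K)) + + 4 * (K * K) * (w₁ - w₀ - 1ℤ) + + 4 * K * (1ℤ - + 2 * d)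
        ≡⟨ cong (λ L → - (+ 8 * (K * K * K)) + + 4 * (K * K) * (L - 1ℤ) + + 4 * K * (1ℤ - + 2 * d))
                (Lsum-weight a (init σ)) ⟨
      - (+ 8 * (K * K * K)) + + 4 * (K * K) * (Lsum a (init σ) - 1ℤ) + + 4 * K * (1ℤ - + 2 * d) ∎
      where
      K  = + 2 ^ k
      d  = + lastDigit false
      d₁ = + lastDigit true
      w₀ = + weight (digitShift false)
      w₁ = + weight (digitShift true)
      P : Bool → ℤ
      P c = ∑[ v ∈ allVecs k ] + binLE v * rows c v
      moment : ℤ → ℤ → ℤ
      moment d w = + 4 * K * (K - 1ℤ) * (K + 1ℤ - d) - + 2 * + k * (K * K) + + 4 * (K * K) * w
      regroup : ∀ P₀ P₁ K U → + 8 * (- P₀ + (P₁ - K * U)) ≡ - (+ 8 * P₀) + + 8 * P₁ - + 8 * K * U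
      regroup = solve-∀
      collect : ∀ K d k w₀ w₁ →
        - (+ 4 * K * (K - 1ℤ) * (K + 1ℤ - d) - + 2 * k * (K * K) + + 4 * (K * K) * w₀)
          + (+ 4 * K * (K - 1ℤ) * (K + 1ℤ - (1ℤ - d)) - + 2 * k * (K * K) + + 4 * (K * K) * w₁)
          - + 8 * K * (K * K + (1ℤ - (1ℤ - d)) * K)
          ≡ - (+ 8 * (K * K * K)) + + 4 * (K * K) * (w₁ - w₀ - 1ℤ) + + 4 * K * (1ℤ - + 2 * d)
      collect = solve-∀

    haarCoeff-pointSet : let K = + 2 ^ k in
      haarCoeff-0-1-00 (suc k) (pointSet a σ)
        ≡ dy (+ 4 * (K * K * K) * (Lsum a (init σ) - 1ℤ) + + 4 * (K * K) * (1ℤ - + 2 * + bit (last σ)))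
             (4 ℕ.* suc k ℕ.+ 2)
    haarCoeff-pointSet = trans (haarCoeff≡dy-cornerIntegral k (pointSet a σ)) (cong (λ z → dy z (4 ℕ.* suc k ℕ.+ 2)) (begin
      + 8 * K * S + + 8 * (K * K * K * K)
        ≡⟨ regroup K S ⟩
      K * (+ 8 * S) + + 8 * (K * K * K * K)
        ≡⟨ cong (λ s → K * s + + 8 * (K * K * K * K)) ∑-cornerIntegral ⟩
      K * (- (+ 8 * (K * K * K)) + + 4 * (K * K) * (L - 1ℤ) + + 4 * K * (1ℤ - + 2 * d)) + + 8 * (K * K * K * K)
        ≡⟨ collect K L d ⟩
      + 4 * (K * K * K) * (L - 1ℤ) + + 4 * (K * K) * (1ℤ - + 2 * d) ∎))
      where
      K = + 2 ^ k
      S = ∑ (pointSet a σ) (cornerIntegral k)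
      L = Lsum a (init σ)
      d = + bit (last σ)
      regroup : ∀ K S → + 8 * K * S + + 8 * (K * K * K * K) ≡ K * (+ 8 * S) + + 8 * (K * K * K * K)
      regroup = solve-∀
      collect : ∀ K L d →
        K * (- (+ 8 * (K * K * K)) + + 4 * (K * K) * (L - 1ℤ) + + 4 * K * (1ℤ - + 2 * d)) + + 8 * (K * K * K * K)
          ≡ + 4 * (K * K * K) * (L - 1ℤ) + + 4 * (K * K) * (1ℤ - + 2 * d)
      collect = solve-∀

module ClosedForm where

  open NatToInt using (pos-2^-+)
  open Fractions using (/-+; /--; dy-rescale)
  open import Data.Integer using (1ℤ; +_; _+_; _-_; _*_)
  open import Data.Integer.Tactic.RingSolver using (solve-∀)
  open import Data.Nat as ℕ using (suc; _^_)
  open import Data.Nat.Properties using (m^n≢0)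
  open import Data.Nat.Tactic.RingSolver using () renaming (solve-∀ to ℕ-solve-∀)
  import Data.Rational as ℚ
  open import Relation.Binary.PropositionalEquality using (_≡_; trans; cong; cong₂; module ≡-Reasoning)
  open ≡-Reasoning

  closedForm≡dy : ∀ k L s → let K = + 2 ^ k in
    dy (+ 1) (2 ℕ.* suc k ℕ.+ 2) ℚ.- dy (+ 1) (suc k ℕ.+ 3) ℚ.+ dy L (suc k ℕ.+ 3) ℚ.- dy s (2 ℕ.* suc k ℕ.+ 1)
      ≡ dy (+ 4 * (K * K * K) * (L - 1ℤ) + + 4 * (K * K) * (1ℤ - + 2 * s)) (4 ℕ.* suc k ℕ.+ 2)
  closedForm≡dy k L s = begin
    dy (+ 1) e₁ ℚ.- dy (+ 1) e₂ ℚ.+ dy L e₂ ℚ.- dy s e₄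
      ≡⟨ cong₂ ℚ._-_ (cong₂ ℚ._+_ (cong₂ ℚ._-_ (dy-rescale (+ 1) e₁ f₁ (exponent₁ k))
                                              (dy-rescale (+ 1) e₂ f₂ (exponent₂ k)))
                                  (dy-rescale L e₂ f₂ (exponent₂ k)))
                     (dy-rescale s e₄ f₄ (exponent₄ k)) ⟩
    dy (+ 1 * P₁) E ℚ.- dy (+ 1 * P₂) E ℚ.+ dy (L * P₂) E ℚ.- dy (s * P₄) E
      ≡⟨ cong (λ q → q ℚ.+ dy (L * P₂) E ℚ.- dy (s * P₄) E) (/-- (+ 1 * P₁) (+ 1 * P₂) (2 ^ E)) ⟩
    dy (+ 1 * P₁ - + 1 * P₂) E ℚ.+ dy (L * P₂) E ℚ.- dy (s * P₄) E
      ≡⟨ cong (ℚ._- dy (s * P₄) E) (/-+ (+ 1 * P₁ - + 1 * P₂) (L * P₂) (2 ^ E)) ⟩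
    dy (+ 1 * P₁ - + 1 * P₂ + L * P₂) E ℚ.- dy (s * P₄) E
      ≡⟨ /-- (+ 1 * P₁ - + 1 * P₂ + L * P₂) (s * P₄) (2 ^ E) ⟩
    dy (+ 1 * P₁ - + 1 * P₂ + L * P₂ - s * P₄) E
      ≡⟨ cong (λ z → dy z E) numerator ⟩
    dy (+ 4 * (K * K * K) * (L - 1ℤ) + + 4 * (K * K) * (1ℤ - + 2 * s)) E ∎
    where
    K = + 2 ^ k
    E = 4 ℕ.* suc k ℕ.+ 2
    e₁ = 2 ℕ.* suc k ℕ.+ 2
    e₂ = suc k ℕ.+ 3
    e₄ = 2 ℕ.* suc k ℕ.+ 1
    f₁ = k ℕ.+ (k ℕ.+ 2)
    f₂ = k ℕ.+ f₁
    f₄ = k ℕ.+ (k ℕ.+ 3)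
    P₁ = + 2 ^ f₁
    P₂ = + 2 ^ f₂
    P₄ = + 2 ^ f₄
    instance
      2^E≢0 : ℕ.NonZero (2 ^ E)
      2^E≢0 = m^n≢0 2 E
    exponent₁ : ∀ k → 2 ℕ.* suc k ℕ.+ 2 ℕ.+ (k ℕ.+ (k ℕ.+ 2)) ≡ 4 ℕ.* suc k ℕ.+ 2
    exponent₁ = ℕ-solve-∀
    exponent₂ : ∀ k → suc k ℕ.+ 3 ℕ.+ (k ℕ.+ (k ℕ.+ (k ℕ.+ 2))) ≡ 4 ℕ.* suc k ℕ.+ 2
    exponent₂ = ℕ-solve-∀
    exponent₄ : ∀ k → 2 ℕ.* suc k ℕ.+ 1 ℕ.+ (k ℕ.+ (k ℕ.+ 3)) ≡ 4 ℕ.* suc k ℕ.+ 2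
    exponent₄ = ℕ-solve-∀
    P₁≡ : P₁ ≡ K * (K * + 4)
    P₁≡ = trans (pos-2^-+ k (k ℕ.+ 2)) (cong (K *_) (pos-2^-+ k 2))
    P₂≡ : P₂ ≡ K * (K * (K * + 4))
    P₂≡ = trans (pos-2^-+ k f₁) (cong (K *_) P₁≡)
    P₄≡ : P₄ ≡ K * (K * + 8)
    P₄≡ = trans (pos-2^-+ k (k ℕ.+ 3)) (cong (K *_) (pos-2^-+ k 3))
    collect : ∀ K L s →
      + 1 * (K * (K * + 4)) - + 1 * (K * (K * (K * + 4))) + L * (K * (K * (K * + 4))) - s * (K * (K * + 8))
        ≡ + 4 * (K * K * K) * (L - 1ℤ) + + 4 * (K * K) * (1ℤ - + 2 * s)
    collect = solve-∀
    numerator : + 1 * P₁ - + 1 * P₂ + L * P₂ - s * P₄ ≡ + 4 * (K * K * K) * (L - 1ℤ) + + 4 * (K * K) * (1ℤ - + 2 * s)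
    numerator = begin
      + 1 * P₁ - + 1 * P₂ + L * P₂ - s * P₄
        ≡⟨ cong₂ (λ p₁ p₂ → + 1 * p₁ - + 1 * p₂ + L * p₂ - s * P₄) P₁≡ P₂≡ ⟩
      + 1 * (K * (K * + 4)) - + 1 * (K * (K * (K * + 4))) + L * (K * (K * (K * + 4))) - s * P₄
        ≡⟨ cong (λ p₄ → + 1 * (K * (K * + 4)) - + 1 * (K * (K * (K * + 4))) + L * (K * (K * (K * + 4))) - s * p₄) P₄≡ ⟩
      + 1 * (K * (K * + 4)) - + 1 * (K * (K * (K * + 4))) + L * (K * (K * (K * + 4))) - s * (K * (K * + 8))
        ≡⟨ collect K L s ⟩
      + 4 * (K * K * K) * (L - 1ℤ) + + 4 * (K * K) * (1ℤ - + 2 * s) ∎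

open import Data.Bool using (Bool)
open import Data.Nat using (ℕ; suc)
open import Data.Integer using (+_)
open import Data.Rational using (_+_; _-_)
open import Data.Vec using (Vec; init; last)
open import Relation.Binary.PropositionalEquality using (_≡_; sym; trans)
open PointSet using (haarCoeff-pointSet)
open ClosedForm using (closedForm≡dy)

proposition5 : (k : ℕ) (a : Vec Bool k) (σ : Vec Bool (suc k)) →
    haarCoeff-0-1-00 (suc k) (pointSet a σ)
      ≡ dy (+ 1) (2 Data.Nat.* suc k Data.Nat.+ 2) - dy (+ 1) (suc k Data.Nat.+ 3)
        + dy (Lsum a (init σ)) (suc k Data.Nat.+ 3)
        - dy (+ bit (last σ)) (2 Data.Nat.* suc k Data.Nat.+ 1)
proposition5 k a σ = trans (haarCoeff-pointSet a σ) (sym (closedForm≡dy k (Lsum a (init σ)) (+ bit (last σ))))
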